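{- Let $G$ be a complete tiered graph. Then for every $k$, $\dim\mathcal{C}^{k}_G=\dim\mathcal{S}^{k}_G$, where the superscript $k$ denotes the degree-$k$ graded component.
   Context: A tiered graph is a simple graph $G=(V,E)$ with vertices labelled $1,\dots,n$ and a surjective tiering function $\mathbf{t}:V\to[m]$, $m\le n$, such that if $(i,j)\in E$ with $i<j$ then $\mathbf{t}(i)<\mathbf{t}(j)$; it is complete if every pair $i<j$ with $\mathbf{t}(i)<\mathbf{t}(j)$ is an edge. Let $\mathbb K$ be a field of characteristic zero. A subgraph $H$ of $G$ is slim if $G\setminus H$ (remove the edges of $H$) is connected. $\Phi_G$ is the graded commutative $\mathbb K$-algebra generated by variables $\phi_e$, $e\in E$, subject to $\phi_e^2=0$ and $\prod_{e\in H}\phi_e=0$ for every non-slim subgraph $H$. $\mathcal C_G$ is the subalgebra of $\Phi_G$ generated by $X_i=\sum_{e}c_{i,e}\phi_e$ ($i=1,\dots,n$), where $c_{i,e}=1$ if $e=(i,j)$ with $i<j$, $c_{i,e}=-1$ if $e=(i,j)$ with $i>j$, and $c_{i,e}=0$ otherwise. For a subgraph $H$, $Z_H=\prod_{e\in H}z_e\in\mathbb K[z_1,\dots,z_n]$ with $z_e=z_i-z_j$ for $e=(i,j)$, $i<j$; $\mathcal S_G$ is the (graded) linear span of $Z_H$ over slim subgraphs $H$ of $G$. -}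

module Defs where

open import Level using (Level; _⊔_) renaming (suc to lsuc; zero to lzero)
open import Algebra.Bundles using (CommutativeRing)
open import Data.Nat as ℕ using (ℕ; zero; suc)
open import Data.Bool using (Bool; true; false; if_then_else_)
open import Data.Fin as Fin using (Fin; _<?_)
open import Data.Fin.Subset using (Subset; inside; outside; ⊥; ⁅_⁆; _∈_; _∉_; _⊆_; _─_; ∣_∣)
open import Data.Fin.Subset.Properties using (_⊆?_; _∈?_)
open import Data.List as List using (List; []; _∷_; _++_; foldr; allFin; cartesianProduct; filter; length; lookup)
open import Data.List.Relation.Unary.All using (All)
open import Data.Vec as Vec using (Vec; []; _∷_)
open import Data.Vec.Properties using (≡-dec)
open import Data.Product using (Σ; _×_; _,_; proj₁; proj₂)
open import Relation.Nullary using (¬_; Dec; yes; no; does)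
open import Relation.Nullary.Decidable using (_×-dec_)
open import Relation.Binary.PropositionalEquality using (_≡_)
import Data.Bool.Properties as BoolP
import Data.Nat.Properties as ℕP

record Field (c ℓ : Level) : Set (lsuc (c ⊔ ℓ)) where
  field
    commutativeRing : CommutativeRing c ℓ
  open CommutativeRing commutativeRing public
  field
    1≉0     : ¬ (1# ≈ 0#)
    inverse : ∀ x → ¬ (x ≈ 0#) → Σ Carrier (λ y → (x * y) ≈ 1#)

module _ {c ℓ : Level} (K : Field c ℓ) where
  open Field K

  ofℕ : ℕ → Carrier
  ofℕ zero    = 0#
  ofℕ (suc n) = 1# + ofℕ n

  CharacteristicZero : Set ℓ
  CharacteristicZero = ∀ n → ¬ (ofℕ (suc n) ≈ 0#)

Surjective : {n m : ℕ} → (Fin n → Fin m) → Set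
Surjective {n} {m} t = (j : Fin m) → Σ (Fin n) (λ i → t i ≡ j)

module LinAlg {c ℓ a e : Level} (K : Field c ℓ)
              (A : Set a) (_≈ᵥ_ : A → A → Set e)
              (0ᵥ : A) (_+ᵥ_ : A → A → A)
              (_·ᵥ_ : Field.Carrier K → A → A) where
  open Field K

  lincomb : List (Carrier × A) → A
  lincomb = foldr (λ p acc → (proj₁ p ·ᵥ proj₂ p) +ᵥ acc) 0ᵥ

  Span : {p : Level} → (A → Set p) → A → Set (c ⊔ a ⊔ e ⊔ p)
  Span P v = Σ (List (Carrier × A)) (λ l → All (λ q → P (proj₂ q)) l × (v ≈ᵥ lincomb l))

  comb : {d : ℕ} → (Fin d → A) → (Fin d → Carrier) → A
  comb {d} b x = foldr (λ i acc → (x i ·ᵥ b i) +ᵥ acc) 0ᵥ (allFin d)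

  LinearlyIndependent : {d : ℕ} → (Fin d → A) → Set (c ⊔ ℓ ⊔ e)
  LinearlyIndependent {d} b = (x : Fin d → Carrier) → comb b x ≈ᵥ 0ᵥ → (i : Fin d) → x i ≈ 0#

  HasDimension : {p : Level} → (A → Set p) → ℕ → Set (c ⊔ ℓ ⊔ a ⊔ e ⊔ p)
  HasDimension W d =
    Σ (Fin d → A) (λ b →
      ((i : Fin d) → W (b i)) ×
      LinearlyIndependent b ×
      ((v : A) → W v → Σ (Fin d → Carrier) (λ x → v ≈ᵥ comb b x)))

allSubsets : (N : ℕ) → List (Subset N)
allSubsets zero    = [] ∷ []
allSubsets (suc N) = List.map (inside ∷_) (allSubsets N) ++ List.map (outside ∷_) (allSubsets N)

module CompleteTiered {c ℓ : Level} (K : Field c ℓ) {n m : ℕ} (t : Fin n → Fin m) where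
  open Field K

  edgeList : List (Fin n × Fin n)
  edgeList = filter (λ p → (proj₁ p <? proj₂ p) ×-dec (t (proj₁ p) <? t (proj₂ p)))
                    (cartesianProduct (allFin n) (allFin n))

  N : ℕ
  N = length edgeList

  src tgt : Fin N → Fin n
  src e = proj₁ (lookup edgeList e)
  tgt e = proj₂ (lookup edgeList e)

  Subgraph : Set
  Subgraph = Subset N

  data Reach (H : Subgraph) : Fin n → Fin n → Set where
    here  : ∀ {i} → Reach H i i
    fwd   : ∀ {j} (e : Fin N) → e ∉ H → Reach H (tgt e) j → Reach H (src e) j
    bwd   : ∀ {j} (e : Fin N) → e ∉ H → Reach H (src e) j → Reach H (tgt e) j

  Connected∖ : Subgraph → Set
  Connected∖ H = (i j : Fin n) → Reach H i j

  Slim : Subgraph → Set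
  Slim H = Connected∖ H

  -- Λ = K[φ_e : e ∈ E] / (φ_e² : e ∈ E): elements are coefficient
  -- functions on squarefree monomials φ_S = ∏_{e∈S} φ_e, S ⊆ E.

  Λ : Set c
  Λ = Subgraph → Carrier

  _≈Λ_ : Λ → Λ → Set ℓ
  f ≈Λ g = (S : Subgraph) → f S ≈ g S

  0Λ : Λ
  0Λ _ = 0#

  _+Λ_ : Λ → Λ → Λ
  (f +Λ g) S = f S + g S

  _·Λ_ : Carrier → Λ → Λ
  (x ·Λ f) S = x * f S

  -Λ_ : Λ → Λ
  (-Λ f) S = - (f S)

  sumK : List Carrier → Carrier
  sumK = foldr _+_ 0#

  _*Λ_ : Λ → Λ → Λ
  (f *Λ g) S = sumK (List.map (λ T → if does (T ⊆? S) then f T * g (S ─ T) else 0#) (allSubsets N))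

  φ : Subgraph → Λ
  φ H S = if does (≡-dec BoolP._≟_ S H) then 1# else 0#

  1Λ : Λ
  1Λ = φ ⊥

  InIdeal : Λ → Set (c ⊔ ℓ)
  InIdeal f = Σ (List (Λ × Subgraph)) (λ l →
                All (λ q → ¬ Slim (proj₂ q)) l ×
                (f ≈Λ foldr (λ q acc → (proj₁ q *Λ φ (proj₂ q)) +Λ acc) 0Λ l))

  -- Φ_G = Λ / ideal : equality in Φ_G
  _≈Φ_ : Λ → Λ → Set (c ⊔ ℓ)
  f ≈Φ g = InIdeal (f +Λ (-Λ g))

  coef : Fin n → Fin N → Carrier
  coef i e with does (i Fin.≟ src e) | does (i Fin.≟ tgt e)
  ... | true  | _     = 1#
  ... | false | true  = - 1#
  ... | false | false = 0#

  X : Fin n → Λ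
  X i = foldr (λ e acc → (coef i e ·Λ φ ⁅ e ⁆) +Λ acc) 0Λ (allFin N)

  -- monomials X_{i1} ⋯ X_{il} (l ≥ 0) span the subalgebra C_G
  prodX : List (Fin n) → Λ
  prodX = foldr (λ i acc → X i *Λ acc) 1Λ

  IsProdX : Λ → Set c
  IsProdX v = Σ (List (Fin n)) (λ l → v ≡ prodX l)

  module LΦ = LinAlg K Λ _≈Φ_ 0Λ _+Λ_ _·Λ_

  HomogΦ : ℕ → Λ → Set (c ⊔ ℓ)
  HomogΦ k v = Σ Λ (λ w → (v ≈Φ w) × ((S : Subgraph) → ¬ (∣ S ∣ ≡ k) → w S ≈ 0#))

  -- C_G^k = C_G ∩ Φ_G^k
  Cdeg : ℕ → Λ → Set (c ⊔ ℓ)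
  Cdeg k v = LΦ.Span IsProdX v × HomogΦ k v

  -- Polynomials in K[z_1,…,z_n]: coefficient functions on exponent
  -- vectors α : Fin n → ℕ.

  Poly : Set c
  Poly = (Fin n → ℕ) → Carrier

  _≈P_ : Poly → Poly → Set ℓ
  p ≈P q = (α : Fin n → ℕ) → p α ≈ q α

  0P : Poly
  0P _ = 0#

  _+P_ : Poly → Poly → Poly
  (p +P q) α = p α + q α

  _·P_ : Carrier → Poly → Poly
  (x ·P p) α = x * p α

  totalDeg : (Fin n → ℕ) → ℕ
  totalDeg α = foldr (λ i acc → α i ℕ.+ acc) 0 (allFin n)

  isZeroExp : (Fin n → ℕ) → Bool
  isZeroExp α = does (totalDeg α ℕP.≟ 0)

  1P : Poly
  1P α = if isZeroExp α then 1# else 0#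

  dec : Fin n → (Fin n → ℕ) → (Fin n → ℕ)
  dec i α j = if does (j Fin.≟ i) then α j ℕ.∸ 1 else α j

  mulZ : Fin n → Poly → Poly
  mulZ i p α with α i
  ... | zero  = 0#
  ... | suc _ = p (dec i α)

  mulZe : Fin N → Poly → Poly
  mulZe e p = mulZ (src e) p +P ((- 1#) ·P mulZ (tgt e) p)

  ZH : Subgraph → Poly
  ZH H = foldr (λ e acc → if does (e ∈? H) then mulZe e acc else acc) 1P (allFin N)

  IsSlimZ : Poly → Set c
  IsSlimZ p = Σ Subgraph (λ H → Slim H × (p ≡ ZH H))

  module LP = LinAlg K Poly _≈P_ 0P _+P_ _·P_

  HomogP : ℕ → Poly → Set ℓ
  HomogP k p = (α : Fin n → ℕ) → ¬ (totalDeg α ≡ k) → p α ≈ 0#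

  -- S_G^k = S_G ∩ (degree-k homogeneous polynomials)
  Sdeg : ℕ → Poly → Set (c ⊔ ℓ)
  Sdeg k p = LP.Span IsSlimZ p × HomogP k p

-- Expanding a product X_{i₁} ⋯ X_{iₖ}, each factor X_i deletes an edge e from S with weight
-- c_{i,e} = ∂z_e/∂zᵢ, so by the Leibniz rule for Z_S = ∏_{e∈S} z_e the coefficient of φ_S is
-- ∂_{i₁} ⋯ ∂_{iₖ} Z_S = α! · [z^α] Z_S, where α counts the letters of the word i₁ ⋯ iₖ.
-- Since a class in Φ_G is determined by its coefficients at slim subgraphs, both spaces are
-- described by the integer matrix M(H, w) = [z^{α(w)}] Z_H, indexed by the slim H with k edges and
-- the words w of length k: up to the factors α!, invertible in characteristic zero, the columns are
-- the generators of C_G^k, and the rows are the degree-k parts of the generators of S_G^k.  So both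
-- dimensions equal the rank r of M.  Fraction-free Gaussian elimination, which can decide whether an
-- integer vanishes in K, produces r pivot rows and r pivot columns that are bases of the row and
-- column spaces.

module Submission where

open import Defs
open import Level using (Level; _⊔_)
open import Algebra.Bundles using (RawRing)
open import Algebra.Solver.Ring.AlmostCommutativeRing using (fromCommutativeRing; _-Raw-AlmostCommutative⟶_)
import Algebra.Solver.Ring as RingSolver
import Algebra.Properties.AbelianGroup as AbelianGroupProperties
import Algebra.Properties.CommutativeSemigroup as CommutativeSemigroupProperties
import Algebra.Properties.Group as GroupProperties
import Algebra.Properties.Ring as RingProperties
import Algebra.Properties.Monoid.Sum as MonoidSum
import Algebra.Properties.Semiring.Mult as SemiringMult
import Algebra.Properties.Semiring.Sum as SemiringSum
open import Data.Bool using (Bool; true; false; if_then_else_)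
import Data.Bool.Properties as BoolP
open import Data.Nat as ℕ using (ℕ; zero; suc; _∸_)
import Data.Nat.Properties as ℕP
open import Data.Fin as Fin using (Fin; punchIn; punchOut)
import Data.Fin.Properties as FinP
open import Data.Fin.Subset using (Subset; _∈_; _∉_; _⊆_; _⊂_; ⁅_⁆; _─_; ∣_∣) renaming (⊥ to ∅)
open import Data.Fin.Subset.Properties using (_∈?_; _⊆?_)
import Data.Fin.Subset.Properties as SubsetP
open import Data.List as List using (List; []; _∷_; _++_; allFin; filter)
open import Data.List.Relation.Unary.All using (All; []; _∷_)
import Data.List.Relation.Unary.All as All
import Data.List.Relation.Unary.All.Properties as AllP
import Data.List.Relation.Unary.Any as Any
import Data.List.Relation.Unary.Any.Properties as AnyP
open import Data.List.Relation.Unary.Unique.Propositional using (Unique; []; _∷_)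
import Data.List.Relation.Unary.Unique.Propositional.Properties as UniqueP
open import Data.List.Membership.Propositional using () renaming (_∈_ to _∈ᴸ_)
import Data.List.Membership.Propositional.Properties as ∈ᴸP
import Data.List.Properties as ListP
open import Data.Maybe using (Maybe; just; nothing)
open import Data.Product using (Σ; ∃; _×_; _,_; proj₁; proj₂)
open import Data.Sum using (_⊎_; inj₁; inj₂)
open import Data.Vec as Vec using ()
open import Data.Vec.Properties as VecP using (≡-dec)
import Data.Vec.Functional as Vector
open import Function using (_∘_)
open import Function.Bundles using (mk⇔; _⇔_; Equivalence)
open import Relation.Binary.PropositionalEquality as ≡ using (_≡_; _≢_; _≗_)
open import Relation.Nullary using (¬_; Dec; yes; no; ¬?; does; contradiction)
open import Relation.Nullary.Decidable using (_×-dec_; _⊎-dec_; _→-dec_; dec-true; dec-false; decidable-stable; does-⇔)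

module FieldProperties {c ℓ : Level} (K : Field c ℓ) where
  open Field K
  open import Relation.Binary.Reasoning.Setoid setoid
  open GroupProperties +-group using (∙-cancelˡ)
  open SemiringMult semiring using (×-homo-+; ×1-homo-*) renaming (_×_ to _×ₙ_)

  _⁻¹ : (x : Carrier) → ¬ x ≈ 0# → Carrier
  (x ⁻¹) x≉0 = proj₁ (inverse x x≉0)

  *-inverseʳ : ∀ x (x≉0 : ¬ x ≈ 0#) → x * (x ⁻¹) x≉0 ≈ 1#
  *-inverseʳ x x≉0 = proj₂ (inverse x x≉0)

  *-inverseˡ : ∀ x (x≉0 : ¬ x ≈ 0#) → (x ⁻¹) x≉0 * x ≈ 1#
  *-inverseˡ x x≉0 = trans (*-comm _ _) (*-inverseʳ x x≉0)

  *-cancelˡ : ∀ {a x y} → ¬ a ≈ 0# → a * x ≈ a * y → x ≈ y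
  *-cancelˡ {a} {x} {y} a≉0 ax≈ay = begin
    x              ≈⟨ *-identityˡ x ⟨
    1# * x         ≈⟨ *-congʳ (*-inverseˡ a a≉0) ⟨
    (a⁻¹ * a) * x  ≈⟨ *-assoc _ _ _ ⟩
    a⁻¹ * (a * x)  ≈⟨ *-congˡ ax≈ay ⟩
    a⁻¹ * (a * y)  ≈⟨ *-assoc _ _ _ ⟨
    (a⁻¹ * a) * y  ≈⟨ *-congʳ (*-inverseˡ a a≉0) ⟩
    1# * y         ≈⟨ *-identityˡ y ⟩
    y              ∎
    where a⁻¹ = (a ⁻¹) a≉0

  *-zero-cancelˡ : ∀ {a x} → ¬ a ≈ 0# → a * x ≈ 0# → x ≈ 0#
  *-zero-cancelˡ {a} a≉0 ax≈0 = *-cancelˡ a≉0 (trans ax≈0 (sym (zeroʳ a)))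

  *-≉0 : ∀ {a b} → ¬ a ≈ 0# → ¬ b ≈ 0# → ¬ a * b ≈ 0#
  *-≉0 a≉0 b≉0 ab≈0 = b≉0 (*-zero-cancelˡ a≉0 ab≈0)

  if-does-≈ : ∀ {p} {P : Set p} (d : Dec P) {x y z} → (P → x ≈ z) → (¬ P → y ≈ z) → (if does d then x else y) ≈ z
  if-does-≈ (yes p) x≈z _ = x≈z p
  if-does-≈ (no ¬p) _ y≈z = y≈z ¬p

  ofℕ≡×1# : ∀ n → ofℕ K n ≡ n ×ₙ 1#
  ofℕ≡×1# zero    = ≡.refl
  ofℕ≡×1# (suc n) = ≡.cong (1# +_) (ofℕ≡×1# n)

  ofℕ-+ : ∀ m n → ofℕ K (m ℕ.+ n) ≈ ofℕ K m + ofℕ K n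
  ofℕ-+ m n rewrite ofℕ≡×1# (m ℕ.+ n) | ofℕ≡×1# m | ofℕ≡×1# n = ×-homo-+ 1# m n

  ofℕ-* : ∀ m n → ofℕ K (m ℕ.* n) ≈ ofℕ K m * ofℕ K n
  ofℕ-* m n rewrite ofℕ≡×1# (m ℕ.* n) | ofℕ≡×1# m | ofℕ≡×1# n = ×1-homo-* m n

  ofℕ-injective : CharacteristicZero K → ∀ {m n} → ofℕ K m ≈ ofℕ K n → m ≡ n
  ofℕ-injective char0 {zero}  {zero}  _ = ≡.refl
  ofℕ-injective char0 {zero}  {suc n} 0≈n+1 = contradiction (sym 0≈n+1) (char0 n)
  ofℕ-injective char0 {suc m} {zero}  m+1≈0 = contradiction m+1≈0 (char0 m)
  ofℕ-injective char0 {suc m} {suc n} eq = ≡.cong suc (ofℕ-injective char0 (∙-cancelˡ 1# _ _ eq))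


-- Formal differences of natural numbers, mapped to K, are the coefficients of the ring solver
-- used below: unlike elements of K, they can be tested for equality, so the solver can cancel.
module IntegerCoefficients {c ℓ : Level} (K : Field c ℓ) where
  open Field K
  open FieldProperties K
  open import Relation.Binary.Reasoning.Setoid setoid
  open GroupProperties +-group using (x∙y⁻¹≈ε⇒x≈y; ⁻¹-anti-homo-//; ε⁻¹≈ε)
  open AbelianGroupProperties +-abelianGroup using (⁻¹-∙-comm)
  open CommutativeSemigroupProperties +-commutativeSemigroup using (interchange)
  open RingProperties ring using (-‿distribˡ-*; -‿distribʳ-*)

  Diff : Set
  Diff = ℕ × ℕ

  diffRawRing : RawRing _ _
  diffRawRing = record
    { Carrier = Diff ; _≈_ = _≡_
    ; _+_ = λ (a , b) (c , d) → a ℕ.+ c , b ℕ.+ d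
    ; _*_ = λ (a , b) (c , d) → a ℕ.* c ℕ.+ b ℕ.* d , a ℕ.* d ℕ.+ b ℕ.* c
    ; -_ = λ (a , b) → b , a
    ; 0# = 0 , 0 ; 1# = 1 , 0 }

  ⟦_⟧ : Diff → Carrier
  ⟦ a , b ⟧ = ofℕ K a - ofℕ K b

  -+-interchange : ∀ a b c d → (a + c) - (b + d) ≈ (a - b) + (c - d)
  -+-interchange a b c d = begin
    (a + c) - (b + d)        ≈⟨ +-congˡ (⁻¹-∙-comm b d) ⟨
    (a + c) + (- b + - d)    ≈⟨ interchange a c (- b) (- d) ⟩
    (a - b) + (c - d)        ∎

  ⟦⟧-+ : ∀ p q → ⟦ RawRing._+_ diffRawRing p q ⟧ ≈ ⟦ p ⟧ + ⟦ q ⟧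
  ⟦⟧-+ (a , b) (c , d) = trans (+-cong (ofℕ-+ a c) (-‿cong (ofℕ-+ b d))) (-+-interchange _ _ _ _)

  ⟦⟧-* : ∀ p q → ⟦ RawRing._*_ diffRawRing p q ⟧ ≈ ⟦ p ⟧ * ⟦ q ⟧
  ⟦⟧-* (a , b) (c , d) = begin
    ofℕ K (a ℕ.* c ℕ.+ b ℕ.* d) - ofℕ K (a ℕ.* d ℕ.+ b ℕ.* c)
      ≈⟨ +-cong (ofℕ-+* a c b d) (-‿cong (ofℕ-+* a d b c)) ⟩
    (A * C + B * D) - (A * D + B * C)     ≈⟨ -+-interchange _ _ _ _ ⟩
    (A * C - A * D) + (B * D - B * C)     ≈⟨ +-congˡ (⁻¹-anti-homo-// _ _) ⟨
    (A * C - A * D) - (B * C - B * D)     ≈⟨ +-cong (*-distribˡ-- A C D) (-‿cong (*-distribˡ-- B C D)) ⟩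
    A * (C - D) - B * (C - D)             ≈⟨ *-distribʳ-- (C - D) A B ⟨
    (A - B) * (C - D)                     ∎
    where
    A = ofℕ K a; B = ofℕ K b; C = ofℕ K c; D = ofℕ K d
    ofℕ-+* : ∀ p q r s → ofℕ K (p ℕ.* q ℕ.+ r ℕ.* s) ≈ ofℕ K p * ofℕ K q + ofℕ K r * ofℕ K s
    ofℕ-+* p q r s = trans (ofℕ-+ (p ℕ.* q) (r ℕ.* s)) (+-cong (ofℕ-* p q) (ofℕ-* r s))
    *-distribˡ-- : ∀ x y z → x * y - x * z ≈ x * (y - z)
    *-distribˡ-- x y z = trans (+-congˡ (-‿distribʳ-* x z)) (sym (distribˡ x y (- z)))
    *-distribʳ-- : ∀ x y z → (y - z) * x ≈ y * x - z * x
    *-distribʳ-- x y z = trans (distribʳ x y (- z)) (+-congˡ (sym (-‿distribˡ-* z x)))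

  ⟦⟧-neg : ∀ p → ⟦ RawRing.-_ diffRawRing p ⟧ ≈ - ⟦ p ⟧
  ⟦⟧-neg (a , b) = sym (⁻¹-anti-homo-// (ofℕ K a) (ofℕ K b))

  ⟦⟧-≈ : ∀ {a b c d} → a ℕ.+ d ≡ c ℕ.+ b → ⟦ a , b ⟧ ≈ ⟦ c , d ⟧
  ⟦⟧-≈ {a} {b} {c} {d} a+d≡c+b = x∙y⁻¹≈ε⇒x≈y _ _ (begin
    (A - B) - (C - D)        ≈⟨ +-congˡ (⁻¹-anti-homo-// C D) ⟩
    (A - B) + (D - C)        ≈⟨ -+-interchange A B D C ⟨
    (A + D) - (B + C)        ≈⟨ +-cong (trans (sym (ofℕ-+ a d)) (reflexive (≡.cong (ofℕ K) a+d≡c+b))) (-‿cong (+-comm B C)) ⟩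
    ofℕ K (c ℕ.+ b) - (C + B) ≈⟨ +-congʳ (ofℕ-+ c b) ⟩
    (C + B) - (C + B)        ≈⟨ -‿inverseʳ _ ⟩
    0#                       ∎)
    where A = ofℕ K a; B = ofℕ K b; C = ofℕ K c; D = ofℕ K d

  ⟦⟧-0 : ⟦ 0 , 0 ⟧ ≈ 0#
  ⟦⟧-0 = -‿inverseʳ 0#

  ⟦⟧-1 : ⟦ 1 , 0 ⟧ ≈ 1#
  ⟦⟧-1 = trans (+-congˡ ε⁻¹≈ε) (trans (+-identityʳ _) (+-identityʳ 1#))

  homomorphism : diffRawRing -Raw-AlmostCommutative⟶ fromCommutativeRing commutativeRing
  homomorphism = record
    { ⟦_⟧ = ⟦_⟧ ; +-homo = ⟦⟧-+ ; *-homo = ⟦⟧-* ; -‿homo = ⟦⟧-neg ; 0-homo = ⟦⟧-0 ; 1-homo = ⟦⟧-1 }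

  ⟦⟧-≈? : ∀ p q → Maybe (⟦ p ⟧ ≈ ⟦ q ⟧)
  ⟦⟧-≈? (a , b) (c , d) with a ℕ.+ d ℕP.≟ c ℕ.+ b
  ... | yes eq = just (⟦⟧-≈ {a} {b} {c} {d} eq)
  ... | no _   = nothing

  open RingSolver diffRawRing (fromCommutativeRing commutativeRing) homomorphism ⟦⟧-≈? public
    using (solve; _:=_; _:+_; _:*_; :-_; _:-_)

module Integers {c ℓ : Level} (K : Field c ℓ) where
  open Field K
  open FieldProperties K
  open IntegerCoefficients K
  open GroupProperties +-group using (x∙y⁻¹≈ε⇒x≈y)
  open RawRing diffRawRing using () renaming (_+_ to _⊞_; _*_ to _⊠_; -_ to ⊟_)

  Integral : Carrier → Set ℓ
  Integral x = Σ Diff λ p → x ≈ ⟦ p ⟧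

  integral-0# : Integral 0#
  integral-0# = (0 , 0) , sym ⟦⟧-0

  integral-1# : Integral 1#
  integral-1# = (1 , 0) , sym ⟦⟧-1

  integral-+ : ∀ {x y} → Integral x → Integral y → Integral (x + y)
  integral-+ (p , x≈) (q , y≈) = p ⊞ q , trans (+-cong x≈ y≈) (sym (⟦⟧-+ p q))

  integral-* : ∀ {x y} → Integral x → Integral y → Integral (x * y)
  integral-* (p , x≈) (q , y≈) = p ⊠ q , trans (*-cong x≈ y≈) (sym (⟦⟧-* p q))

  integral-neg : ∀ {x} → Integral x → Integral (- x)
  integral-neg (p , x≈) = ⊟ p , trans (-‿cong x≈) (sym (⟦⟧-neg p))

  integral-minor : ∀ {a b c d} → Integral a → Integral b → Integral c → Integral d →
                   Integral (a * b - c * d)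
  integral-minor ia ib ic id = integral-+ (integral-* ia ib) (integral-neg (integral-* ic id))

  integral-≈0? : CharacteristicZero K → ∀ {x} → Integral x → Dec (x ≈ 0#)
  integral-≈0? char0 {x} ((a , b) , x≈) with a ℕP.≟ b
  ... | yes ≡.refl = yes (trans x≈ (-‿inverseʳ _))
  ... | no a≢b = no λ x≈0 → a≢b (ofℕ-injective char0 (x∙y⁻¹≈ε⇒x≈y _ _ (trans (sym x≈) x≈0)))

module Sums {c ℓ : Level} (K : Field c ℓ) where
  open Field K
  open import Relation.Binary.Reasoning.Setoid setoid
  open SemiringSum semiring using (sum; sum-cong-≋; sum-replicate-zero)
  open IntegerCoefficients K using (solve; _:=_; _:+_)

  ∑ᴸ : ∀ {a} {A : Set a} → (A → Carrier) → List A → Carrier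
  ∑ᴸ f xs = List.foldr _+_ 0# (List.map f xs)

  private variable
    a b : Level
    A : Set a
    B : Set b

  ∑ᴸ-cong : ∀ {f g : A → Carrier} xs → (∀ x → f x ≈ g x) → ∑ᴸ f xs ≈ ∑ᴸ g xs
  ∑ᴸ-cong []       f≈g = refl
  ∑ᴸ-cong (x ∷ xs) f≈g = +-cong (f≈g x) (∑ᴸ-cong xs f≈g)

  ∑ᴸ-congᴬ : ∀ {f g : A → Carrier} {xs} → All (λ x → f x ≈ g x) xs → ∑ᴸ f xs ≈ ∑ᴸ g xs
  ∑ᴸ-congᴬ []           = refl
  ∑ᴸ-congᴬ (fx≈gx ∷ rest) = +-cong fx≈gx (∑ᴸ-congᴬ rest)

  ∑ᴸ-≈0 : ∀ {f : A → Carrier} xs → (∀ x → f x ≈ 0#) → ∑ᴸ f xs ≈ 0#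
  ∑ᴸ-≈0 []       f≈0 = refl
  ∑ᴸ-≈0 (x ∷ xs) f≈0 = trans (+-cong (f≈0 x) (∑ᴸ-≈0 xs f≈0)) (+-identityʳ 0#)

  ∑ᴸ-++ : ∀ (f : A → Carrier) xs ys → ∑ᴸ f (xs ++ ys) ≈ ∑ᴸ f xs + ∑ᴸ f ys
  ∑ᴸ-++ f []       ys = sym (+-identityˡ _)
  ∑ᴸ-++ f (x ∷ xs) ys = trans (+-congˡ (∑ᴸ-++ f xs ys)) (sym (+-assoc _ _ _))

  ∑ᴸ-map : ∀ (f : A → Carrier) (g : B → A) xs → ∑ᴸ f (List.map g xs) ≡ ∑ᴸ (f ∘ g) xs
  ∑ᴸ-map f g xs = ≡.cong (List.foldr _+_ 0#) (≡.sym (ListP.map-∘ xs))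

  ∑ᴸ-distrib-+ : ∀ (f g : A → Carrier) xs → ∑ᴸ (λ x → f x + g x) xs ≈ ∑ᴸ f xs + ∑ᴸ g xs
  ∑ᴸ-distrib-+ f g []       = sym (+-identityˡ 0#)
  ∑ᴸ-distrib-+ f g (x ∷ xs) = trans (+-congˡ (∑ᴸ-distrib-+ f g xs))
    (solve 4 (λ a b u v → (a :+ b) :+ (u :+ v) := (a :+ u) :+ (b :+ v)) refl (f x) (g x) (∑ᴸ f xs) (∑ᴸ g xs))

  *-distribˡ-∑ᴸ : ∀ a (f : A → Carrier) xs → a * ∑ᴸ f xs ≈ ∑ᴸ (λ x → a * f x) xs
  *-distribˡ-∑ᴸ a f []       = zeroʳ a
  *-distribˡ-∑ᴸ a f (x ∷ xs) = trans (distribˡ _ _ _) (+-congˡ (*-distribˡ-∑ᴸ a f xs))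

  *-distribʳ-∑ᴸ : ∀ a (f : A → Carrier) xs → ∑ᴸ f xs * a ≈ ∑ᴸ (λ x → f x * a) xs
  *-distribʳ-∑ᴸ a f []       = zeroˡ a
  *-distribʳ-∑ᴸ a f (x ∷ xs) = trans (distribʳ _ _ _) (+-congˡ (*-distribʳ-∑ᴸ a f xs))

  ∑ᴸ-comm : ∀ (f : A → B → Carrier) xs ys →
            ∑ᴸ (λ x → ∑ᴸ (f x) ys) xs ≈ ∑ᴸ (λ y → ∑ᴸ (λ x → f x y) xs) ys
  ∑ᴸ-comm f []       ys = sym (∑ᴸ-≈0 ys λ _ → refl)
  ∑ᴸ-comm f (x ∷ xs) ys = trans (+-congˡ (∑ᴸ-comm f xs ys)) (sym (∑ᴸ-distrib-+ (f x) _ ys))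

  ∑ᴸ-filter : ∀ {p} {P : A → Set p} (P? : ∀ x → Dec (P x)) (f : A → Carrier) xs →
              ∑ᴸ f (filter P? xs) ≈ ∑ᴸ (λ x → if does (P? x) then f x else 0#) xs
  ∑ᴸ-filter P? f [] = refl
  ∑ᴸ-filter P? f (x ∷ xs) with does (P? x)
  ... | true  = +-congˡ (∑ᴸ-filter P? f xs)
  ... | false = trans (∑ᴸ-filter P? f xs) (sym (+-identityˡ _))

  ∑ᴸ-tabulate : ∀ {d} (f : A → Carrier) (g : Fin d → A) → ∑ᴸ f (List.tabulate g) ≡ sum (f ∘ g)
  ∑ᴸ-tabulate {d = zero}  f g = ≡.refl
  ∑ᴸ-tabulate {d = suc d} f g = ≡.cong (f (g Fin.zero) +_) (∑ᴸ-tabulate f (g ∘ Fin.suc))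

  ∑ᴸ-allFin : ∀ {d} (f : Fin d → Carrier) → ∑ᴸ f (allFin d) ≡ sum f
  ∑ᴸ-allFin f = ∑ᴸ-tabulate f (λ i → i)

  -- lincomb, comb, X i and IdealSum, evaluated at a point, unfold to the left-hand side.
  foldr-+-at : ∀ {X : Set} (F : A → X → Carrier) xs x →
               List.foldr (λ a acc y → F a y + acc y) (λ _ → 0#) xs x ≡ ∑ᴸ (λ a → F a x) xs
  foldr-+-at F []       x = ≡.refl
  foldr-+-at F (a ∷ xs) x = ≡.cong (F a x +_) (foldr-+-at F xs x)

  ∑ᴸ-allSubsets-δ : ∀ {M} (g : Subset M → Carrier) T₀ → (∀ T → T ≢ T₀ → g T ≈ 0#) →
                    ∑ᴸ g (allSubsets M) ≈ g T₀
  ∑ᴸ-allSubsets-δ {zero}  g Vec.[]       _   = +-identityʳ _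
  ∑ᴸ-allSubsets-δ {suc M} g (b Vec.∷ T₀) g≈0 = begin
    ∑ᴸ g (List.map (true Vec.∷_) (allSubsets M) ++ List.map (false Vec.∷_) (allSubsets M))
      ≈⟨ ∑ᴸ-++ g (List.map (true Vec.∷_) (allSubsets M)) (List.map (false Vec.∷_) (allSubsets M)) ⟩
    ∑ᴸ g (List.map (true Vec.∷_) (allSubsets M)) + ∑ᴸ g (List.map (false Vec.∷_) (allSubsets M))
      ≡⟨ ≡.cong₂ _+_ (∑ᴸ-map g _ (allSubsets M)) (∑ᴸ-map g _ (allSubsets M)) ⟩
    ∑ᴸ (g ∘ (true Vec.∷_)) (allSubsets M) + ∑ᴸ (g ∘ (false Vec.∷_)) (allSubsets M)
      ≈⟨ halves b g≈0 ⟩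
    g (b Vec.∷ T₀) ∎
    where
    restrict : ∀ {b′ b} → (∀ T → T ≢ b Vec.∷ T₀ → g T ≈ 0#) → ∀ T → T ≢ T₀ → g (b′ Vec.∷ T) ≈ 0#
    restrict g≈0 T T≢T₀ = g≈0 _ (T≢T₀ ∘ VecP.∷-injectiveʳ)
    halves : ∀ b → (∀ T → T ≢ b Vec.∷ T₀ → g T ≈ 0#) →
             ∑ᴸ (g ∘ (true Vec.∷_)) (allSubsets M) + ∑ᴸ (g ∘ (false Vec.∷_)) (allSubsets M) ≈ g (b Vec.∷ T₀)
    halves true g≈0 = trans (+-cong (∑ᴸ-allSubsets-δ _ T₀ (restrict g≈0)) (∑ᴸ-≈0 (allSubsets M) λ T → g≈0 _ λ ()))
                            (+-identityʳ _)
    halves false g≈0 = trans (+-cong (∑ᴸ-≈0 (allSubsets M) λ T → g≈0 _ λ ()) (∑ᴸ-allSubsets-δ _ T₀ (restrict g≈0)))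
                             (+-identityˡ _)

  sum-≈0 : ∀ {n} {f : Fin n → Carrier} → (∀ i → f i ≈ 0#) → sum f ≈ 0#
  sum-≈0 {n} f≈0 = trans (sum-cong-≋ f≈0) (sum-replicate-zero n)

punchIn-cases : ∀ {n p} {P : Fin (suc n) → Set p} (i : Fin (suc n)) →
                P i → (∀ j → P (punchIn i j)) → ∀ j → P j
punchIn-cases {P = P} i Pi P-punchIn j with i Fin.≟ j
... | yes ≡.refl = Pi
... | no i≢j     = ≡.subst P (FinP.punchIn-punchOut i≢j) (P-punchIn (punchOut i≢j))

module GaussianElimination {c ℓ : Level} (K : Field c ℓ) where
  open Field K
  open FieldProperties K
  open IntegerCoefficients K using (solve; _:=_; _:+_; _:*_; :-_; _:-_)
  open Sums K using (sum-≈0)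
  open SemiringSum semiring using (sum; sum-cong-≋; *-distribˡ-sum; ∑-distrib-+)
  open RingProperties ring using (-‿distribˡ-*)
  open import Relation.Binary.Reasoning.Setoid setoid

  Matrix : ℕ → ℕ → Set c
  Matrix R C = Fin R → Fin C → Carrier

  _ᵀ : ∀ {R C} → Matrix R C → Matrix C R
  (M ᵀ) j i = M i j

  record IsRowBasis {R C r : ℕ} (M : Matrix R C) (I : Fin r → Fin R) : Set (c ⊔ ℓ) where
    field
      independent : ∀ (x : Fin r → Carrier) → (∀ j → sum (λ s → x s * M (I s) j) ≈ 0#) → ∀ s → x s ≈ 0#
      spanning    : ∀ i → Σ (Fin r → Carrier) λ y → ∀ j → M i j ≈ sum (λ s → y s * M (I s) j)

  record RankDecomposition {R C : ℕ} (M : Matrix R C) : Set (c ⊔ ℓ) where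
    field
      rank      : ℕ
      pivotRows : Fin rank → Fin R
      pivotCols : Fin rank → Fin C
      rowBasis  : IsRowBasis M pivotRows
      colBasis  : IsRowBasis (M ᵀ) pivotCols

  sum-*-minor : ∀ {n} (x P Q : Fin n → Carrier) a b →
                sum (λ s → x s * (a * P s - b * Q s)) ≈ a * sum (λ s → x s * P s) - b * sum (λ s → x s * Q s)
  sum-*-minor x P Q a b = begin
    sum (λ s → x s * (a * P s - b * Q s))
      ≈⟨ sum-cong-≋ (λ s → solve 5 (λ x P Q a b → x :* (a :* P :- b :* Q) := a :* (x :* P) :+ (:- b) :* (x :* Q)) refl (x s) (P s) (Q s) a b) ⟩
    sum (λ s → a * (x s * P s) + (- b) * (x s * Q s))
      ≈⟨ ∑-distrib-+ (λ s → a * (x s * P s)) (λ s → (- b) * (x s * Q s)) ⟩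
    sum (λ s → a * (x s * P s)) + sum (λ s → (- b) * (x s * Q s))
      ≈⟨ +-cong (*-distribˡ-sum a (λ s → x s * P s)) (*-distribˡ-sum (- b) (λ s → x s * Q s)) ⟨
    a * sum (λ s → x s * P s) + (- b) * sum (λ s → x s * Q s)
      ≈⟨ +-congˡ (-‿distribˡ-* b _) ⟨
    a * sum (λ s → x s * P s) - b * sum (λ s → x s * Q s) ∎

  IsRowBasis-resp : ∀ {R C r} {M N : Matrix R C} {I : Fin r → Fin R} →
                    (∀ i j → M i j ≈ N i j) → IsRowBasis M I → IsRowBasis N I
  IsRowBasis-resp {I = I} M≈N basis = record
    { independent = λ x Σ≈0 → independent x λ j → trans (sum-cong-≋ λ s → *-congˡ (M≈N (I s) j)) (Σ≈0 j)
    ; spanning = λ i → let (y , M≈) = spanning i in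
        y , λ j → trans (sym (M≈N i j)) (trans (M≈ j) (sum-cong-≋ λ s → *-congˡ (M≈N (I s) j)))
    }
    where open IsRowBasis basis

  zeroRankDecomposition : ∀ {R C} {M : Matrix R C} → (∀ i j → M i j ≈ 0#) → RankDecomposition M
  zeroRankDecomposition M≈0 = record
    { rank = 0 ; pivotRows = λ () ; pivotCols = λ ()
    ; rowBasis = record { independent = λ _ _ () ; spanning = λ i → (λ ()) , λ j → M≈0 i j }
    ; colBasis = record { independent = λ _ _ () ; spanning = λ j → (λ ()) , λ i → M≈0 i j }
    }

  -- Row i and column j are removed; scaling by the pivot M i j instead of dividing by it
  -- makes every entry a 2 × 2 minor of M.
  schurComplement : ∀ {R C} → Matrix (suc R) (suc C) → Fin (suc R) → Fin (suc C) → Matrix R C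
  schurComplement M i j ρ c = M i j * M (punchIn i ρ) (punchIn j c) - M i (punchIn j c) * M (punchIn i ρ) j

  schurComplement-ᵀ : ∀ {R C} (M : Matrix (suc R) (suc C)) i j c ρ →
                      schurComplement (M ᵀ) j i c ρ ≈ (schurComplement M i j ᵀ) c ρ
  schurComplement-ᵀ M i j c ρ = +-congˡ (-‿cong (*-comm _ _))

  module Pivot {R C r : ℕ} (M : Matrix (suc R) (suc C)) (i : Fin (suc R)) (j : Fin (suc C))
               (M≉0 : ¬ M i j ≈ 0#) {I : Fin r → Fin R}
               (basis : IsRowBasis (schurComplement M i j) I) where
    open IsRowBasis basis
    private
      α = M i j
      M′ = schurComplement M i j
      rowComb : (Fin r → Carrier) → Fin (suc C) → Carrier
      rowComb x col = sum (λ s → x s * M (punchIn i (I s)) col)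

    sum-schurComplement : ∀ x c → sum (λ s → x s * M′ (I s) c) ≈ α * rowComb x (punchIn j c) - M i (punchIn j c) * rowComb x j
    sum-schurComplement x c = sum-*-minor x (λ s → M (punchIn i (I s)) (punchIn j c)) (λ s → M (punchIn i (I s)) j) α (M i (punchIn j c))

    independent⁺ : ∀ (x : Fin (suc r) → Carrier) → (∀ col → sum (λ s → x s * M ((i Vector.∷ punchIn i ∘ I) s) col) ≈ 0#) → ∀ s → x s ≈ 0#
    independent⁺ x Σ≈0 = vanishes
      where
      x₀ = x Fin.zero
      x′ = x ∘ Fin.suc
      tail≈0 : ∀ s → x′ s ≈ 0#
      tail≈0 = independent x′ λ c → let b = M i (punchIn j c) in begin
        sum (λ s → x′ s * M′ (I s) c)                            ≈⟨ sum-schurComplement x′ c ⟩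
        α * rowComb x′ (punchIn j c) - b * rowComb x′ j          ≈⟨ solve 5 (λ α b x₀ t u → α :* t :- b :* u := α :* (x₀ :* b :+ t) :- b :* (x₀ :* α :+ u)) refl α b x₀ _ _ ⟩
        α * (x₀ * b + rowComb x′ (punchIn j c)) - b * (x₀ * α + rowComb x′ j)
                                                                 ≈⟨ +-cong (*-congˡ (Σ≈0 (punchIn j c))) (-‿cong (*-congˡ (Σ≈0 j))) ⟩
        α * 0# - b * 0#                                          ≈⟨ +-cong (zeroʳ α) (-‿cong (zeroʳ b)) ⟩
        0# - 0#                                                  ≈⟨ -‿inverseʳ 0# ⟩
        0#                                                       ∎
      x₀≈0 : x₀ ≈ 0#
      x₀≈0 = *-zero-cancelˡ M≉0 (begin
        α * x₀                    ≈⟨ trans (*-comm α x₀) (sym (+-identityʳ _)) ⟩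
        x₀ * α + 0#               ≈⟨ +-congˡ (sum-≈0 λ s → trans (*-congʳ (tail≈0 s)) (zeroˡ _)) ⟨
        x₀ * α + rowComb x′ j     ≈⟨ Σ≈0 j ⟩
        0#                        ∎)
      vanishes : ∀ s → x s ≈ 0#
      vanishes Fin.zero    = x₀≈0
      vanishes (Fin.suc s) = tail≈0 s

    spanning⁺ : ∀ ρ → Σ (Fin (suc r) → Carrier) λ y →
                ∀ col → M ρ col ≈ sum (λ s → y s * M ((i Vector.∷ punchIn i ∘ I) s) col)
    spanning⁺ = punchIn-cases i pivotRow otherRow
      where
      pivotRow : Σ (Fin (suc r) → Carrier) λ y → ∀ col → M i col ≈ sum (λ s → y s * M ((i Vector.∷ punchIn i ∘ I) s) col)
      pivotRow = (1# Vector.∷ λ _ → 0#) , λ col →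
        sym (trans (+-cong (*-identityˡ _) (sum-≈0 λ s → zeroˡ (M (punchIn i (I s)) col))) (+-identityʳ _))

      otherRow : ∀ ρ → Σ (Fin (suc r) → Carrier) λ y →
                 ∀ col → M (punchIn i ρ) col ≈ sum (λ s → y s * M ((i Vector.∷ punchIn i ∘ I) s) col)
      otherRow ρ = (α⁻¹ * D Vector.∷ y) , punchIn-cases j atPivotCol atOtherCol
        where
        y = proj₁ (spanning ρ)
        m = M (punchIn i ρ)
        S = rowComb y
        D = m j - S j
        α⁻¹ = (α ⁻¹) M≉0
        atPivotCol : m j ≈ α⁻¹ * D * α + S j
        atPivotCol = sym (begin
          α⁻¹ * D * α + S j     ≈⟨ +-congʳ (solve 3 (λ α⁻¹ D α → α⁻¹ :* D :* α := (α⁻¹ :* α) :* D) refl α⁻¹ D α) ⟩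
          (α⁻¹ * α) * D + S j   ≈⟨ +-congʳ (trans (*-congʳ (*-inverseˡ α M≉0)) (*-identityˡ D)) ⟩
          (m j - S j) + S j     ≈⟨ solve 2 (λ m S → m :- S :+ S := m) refl (m j) (S j) ⟩
          m j                   ∎)
        atOtherCol : ∀ c → m (punchIn j c) ≈ α⁻¹ * D * M i (punchIn j c) + S (punchIn j c)
        atOtherCol c = *-cancelˡ M≉0 (begin
          α * m (punchIn j c)                       ≈⟨ solve 4 (λ α mc b mj → α :* mc := (α :* mc :- b :* mj) :+ b :* mj) refl α (m (punchIn j c)) b (m j) ⟩
          M′ ρ c + b * m j                          ≈⟨ +-congʳ (trans (proj₂ (spanning ρ) c) (sum-schurComplement y c)) ⟩
          (α * S (punchIn j c) - b * S j) + b * m j ≈⟨ solve 5 (λ α Sc b Sj mj → (α :* Sc :- b :* Sj) :+ b :* mj := (mj :- Sj) :* b :+ α :* Sc) refl α (S (punchIn j c)) b (S j) (m j) ⟩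
          D * b + α * S (punchIn j c)               ≈⟨ +-congʳ (trans (*-congʳ (*-inverseʳ α M≉0)) (*-identityˡ _)) ⟨
          (α * α⁻¹) * (D * b) + α * S (punchIn j c) ≈⟨ solve 5 (λ α α⁻¹ D b Sc → (α :* α⁻¹) :* (D :* b) :+ α :* Sc := α :* (α⁻¹ :* D :* b :+ Sc)) refl α α⁻¹ D b (S (punchIn j c)) ⟩
          α * (α⁻¹ * D * b + S (punchIn j c))       ∎)
          where b = M i (punchIn j c)

    isRowBasis : IsRowBasis M (i Vector.∷ punchIn i ∘ I)
    isRowBasis = record { independent = independent⁺ ; spanning = spanning⁺ }

  pivot : ∀ {R C} {M : Matrix (suc R) (suc C)} {i j} → ¬ M i j ≈ 0# →
          RankDecomposition (schurComplement M i j) → RankDecomposition M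
  pivot {M = M} {i} {j} M≉0 decomposition = record
    { rank      = suc rank
    ; pivotRows = i Vector.∷ punchIn i ∘ pivotRows
    ; pivotCols = j Vector.∷ punchIn j ∘ pivotCols
    ; rowBasis  = Pivot.isRowBasis M i j M≉0 rowBasis
    ; colBasis  = Pivot.isRowBasis (M ᵀ) j i M≉0
                    (IsRowBasis-resp (λ c ρ → sym (schurComplement-ᵀ M i j c ρ)) colBasis)
    }
    where open RankDecomposition decomposition

  -- Pivoting needs to decide whether an entry vanishes; this is possible on a subset of K closed
  -- under 2 × 2 minors with decidable vanishing, such as the integers in characteristic zero.
  module _ {p} {P : Carrier → Set p}
           (P-minor : ∀ {a b c d} → P a → P b → P c → P d → P (a * b - c * d))
           (P-≈0? : ∀ {x} → P x → Dec (x ≈ 0#)) where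

    rankDecomposition : ∀ {R C} (M : Matrix R C) → (∀ i j → P (M i j)) → RankDecomposition M
    rankDecomposition {zero}  M _ = zeroRankDecomposition λ ()
    rankDecomposition {suc R} {zero} M _ = zeroRankDecomposition λ _ ()
    rankDecomposition {suc R} {suc C} M PM with FinP.any? (λ i → FinP.any? (λ j → ¬? (P-≈0? (PM i j))))
    ... | no noPivot = zeroRankDecomposition λ i j →
            decidable-stable (P-≈0? (PM i j)) λ M≉0 → noPivot (i , j , M≉0)
    ... | yes (i , j , M≉0) = pivot M≉0 (rankDecomposition (schurComplement M i j) λ ρ c →
            P-minor (PM i j) (PM (punchIn i ρ) (punchIn j c)) (PM i (punchIn j c)) (PM (punchIn i ρ) j))

∈-allSubsets : ∀ {M} (S : Subset M) → S ∈ᴸ allSubsets M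
∈-allSubsets {zero}  Vec.[]            = Any.here ≡.refl
∈-allSubsets {suc M} (true Vec.∷ S)  = ∈ᴸP.∈-++⁺ˡ (∈ᴸP.∈-map⁺ (true Vec.∷_) (∈-allSubsets S))
∈-allSubsets {suc M} (false Vec.∷ S) = ∈ᴸP.∈-++⁺ʳ _ (∈ᴸP.∈-map⁺ (false Vec.∷_) (∈-allSubsets S))

∈-tabulate⁺ : ∀ {n p} {P : Fin n → Set p} (P? : ∀ v → Dec (P v)) {v} → P v → v ∈ Vec.tabulate (does ∘ P?)
∈-tabulate⁺ P? {v} Pv = VecP.lookup⇒[]= v _ (≡.trans (VecP.lookup∘tabulate _ v) (dec-true (P? v) Pv))

∈-tabulate⁻ : ∀ {n p} {P : Fin n → Set p} (P? : ∀ v → Dec (P v)) {v} → v ∈ Vec.tabulate (does ∘ P?) → P v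
∈-tabulate⁻ P? {v} v∈ with P? v | ≡.trans (≡.sym (VecP.lookup∘tabulate (does ∘ P?) v)) (VecP.[]=⇒lookup v∈)
... | yes Pv | _ = Pv
... | no _   | ()

⁅x⁆⊆⇔∈ : ∀ {M} {x : Fin M} {S} → ⁅ x ⁆ ⊆ S ⇔ x ∈ S
⁅x⁆⊆⇔∈ {x = x} {S} = mk⇔ (λ ⁅x⁆⊆S → ⁅x⁆⊆S (SubsetP.x∈⁅x⁆ x))
                          (λ x∈S {y} y∈⁅x⁆ → ≡.subst (_∈ S) (≡.sym (SubsetP.x∈⁅y⁆⇒x≡y x y∈⁅x⁆)) x∈S)

x∈p─q⇒x∉q : ∀ {M} (p q : Subset M) {x} → x ∈ p ─ q → x ∉ q
x∈p─q⇒x∉q (_ Vec.∷ p) (true  Vec.∷ q) {Fin.zero}  ()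
x∈p─q⇒x∉q (_ Vec.∷ p) (false Vec.∷ q) {Fin.zero}  _  ()
x∈p─q⇒x∉q (_ Vec.∷ p) (_     Vec.∷ q) {Fin.suc x} x∈ x∈q = x∈p─q⇒x∉q p q (SubsetP.drop-there x∈) (SubsetP.drop-there x∈q)

∈-─⁅⁆-other : ∀ {M} (H : Subset M) {x y} → y ≢ x → does (x ∈? H ─ ⁅ y ⁆) ≡ does (x ∈? H)
∈-─⁅⁆-other H {x} {y} y≢x = does-⇔ (mk⇔ (SubsetP.p─q⊆p H ⁅ y ⁆) (λ x∈H → SubsetP.x∈p∧x≢y⇒x∈p-y x∈H (y≢x ∘ ≡.sym)))
                                     (x ∈? H ─ ⁅ y ⁆) (x ∈? H)

∈-─⁅⁆-self : ∀ {M} (H : Subset M) x → does (x ∈? H ─ ⁅ x ⁆) ≡ false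
∈-─⁅⁆-self H x = dec-false (x ∈? H ─ ⁅ x ⁆) λ x∈ → x∈p─q⇒x∉q H ⁅ x ⁆ x∈ (SubsetP.x∈⁅x⁆ x)

length-filter-∈?-suc : ∀ {M d} b (H : Subset M) (g : Fin d → Fin M) →
  List.length (filter (_∈? (b Vec.∷ H)) (List.tabulate (Fin.suc ∘ g))) ≡ List.length (filter (_∈? H) (List.tabulate g))
length-filter-∈?-suc {d = zero}  b H g = ≡.refl
length-filter-∈?-suc {d = suc d} b H g with does (g Fin.zero ∈? H)
... | true  = ≡.cong suc (length-filter-∈?-suc b H (g ∘ Fin.suc))
... | false = length-filter-∈?-suc b H (g ∘ Fin.suc)

∣∣≡length-filter : ∀ {M} (H : Subset M) → ∣ H ∣ ≡ List.length (filter (_∈? H) (allFin M))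
∣∣≡length-filter {zero}  Vec.[]          = ≡.refl
∣∣≡length-filter {suc M} (true Vec.∷ H)  = ≡.cong suc (≡.trans (∣∣≡length-filter H) (≡.sym (length-filter-∈?-suc true H (λ j → j))))
∣∣≡length-filter {suc M} (false Vec.∷ H) = ≡.trans (∣∣≡length-filter H) (≡.sym (length-filter-∈?-suc false H (λ j → j)))

∣∣≡0⇒≡∅ : ∀ {M} (S : Subset M) → ∣ S ∣ ≡ 0 → S ≡ ∅
∣∣≡0⇒≡∅ S ∣S∣≡0 = SubsetP.Empty-unique λ (x , x∈S) →
  ℕP.<⇒≱ (ℕ.s≤s ℕ.z≤n) (≡.subst₂ ℕ._≤_ (SubsetP.∣⁅x⁆∣≡1 x) ∣S∣≡0 (SubsetP.p⊆q⇒∣p∣≤∣q∣ (Equivalence.from ⁅x⁆⊆⇔∈ x∈S)))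

inc : ∀ {d} → Fin d → (Fin d → ℕ) → (Fin d → ℕ)
inc i α j = if does (j Fin.≟ i) then suc (α j) else α j

inc-self : ∀ {d} (i : Fin d) α → inc i α i ≡ suc (α i)
inc-self i α with i Fin.≟ i
... | yes _   = ≡.refl
... | no i≢i = contradiction ≡.refl i≢i

inc-other : ∀ {d} {i j : Fin d} α → j ≢ i → inc i α j ≡ α j
inc-other {i = i} {j} α j≢i with j Fin.≟ i
... | yes j≡i = contradiction j≡i j≢i
... | no _    = ≡.refl

inc-cong : ∀ {d} (i : Fin d) {α β : Fin d → ℕ} → α ≗ β → inc i α ≗ inc i β
inc-cong i α≗β j = ≡.cong (λ x → if does (j Fin.≟ i) then suc x else x) (α≗β j)

open MonoidSum ℕP.+-0-monoid using () renaming (sum to ∑ℕ)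

∑ℕ-inc : ∀ {d} (i : Fin d) (α : Fin d → ℕ) → ∑ℕ (inc i α) ≡ suc (∑ℕ α)
∑ℕ-inc Fin.zero    α = ≡.refl
∑ℕ-inc (Fin.suc i) α = ≡.trans (≡.cong (α Fin.zero ℕ.+_) (∑ℕ-inc i (α ∘ Fin.suc))) (ℕP.+-suc _ _)

∑ℕ-dec : ∀ {d} (a : Fin d) (α : Fin d → ℕ) {k} → α a ≡ suc k →
         ∑ℕ α ≡ suc (∑ℕ (λ j → if does (j Fin.≟ a) then α j ∸ 1 else α j))
∑ℕ-dec Fin.zero    α αa≡ rewrite αa≡ = ≡.refl
∑ℕ-dec (Fin.suc a) α αa≡ = ≡.trans (≡.cong (α Fin.zero ℕ.+_) (∑ℕ-dec a (α ∘ Fin.suc) αa≡)) (ℕP.+-suc _ _)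

module Reachability {c ℓ : Level} (K : Field c ℓ) {n m : ℕ} (t : Fin n → Fin m) where
  open CompleteTiered K t

  Reach-trans : ∀ {H i j k} → Reach H i j → Reach H j k → Reach H i k
  Reach-trans here          q = q
  Reach-trans (fwd e e∉H p) q = fwd e e∉H (Reach-trans p q)
  Reach-trans (bwd e e∉H p) q = bwd e e∉H (Reach-trans p q)

  Reach-antitone : ∀ {H S} → H ⊆ S → ∀ {i j} → Reach S i j → Reach H i j
  Reach-antitone H⊆S here          = here
  Reach-antitone H⊆S (fwd e e∉S p) = fwd e (e∉S ∘ H⊆S) (Reach-antitone H⊆S p)
  Reach-antitone H⊆S (bwd e e∉S p) = bwd e (e∉S ∘ H⊆S) (Reach-antitone H⊆S p)

  Slim-antitone : ∀ {H S} → H ⊆ S → Slim S → Slim H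
  Slim-antitone H⊆S slim i j = Reach-antitone H⊆S (slim i j)

  -- The vertices reachable from u are found by repeatedly adding the neighbours in G ∖ H;
  -- the resulting increasing sequence of subsets of Fin n is stationary after n steps.
  module ReachableSet (H : Subgraph) where
    Adjacent : Subset n → Fin n → Set
    Adjacent R v = ∃ λ e → e ∉ H × ((src e ∈ R × tgt e ≡ v) ⊎ (tgt e ∈ R × src e ≡ v))

    adjacent? : ∀ R v → Dec (Adjacent R v)
    adjacent? R v = FinP.any? λ e → ¬? (e ∈? H) ×-dec
      ((src e ∈? R ×-dec tgt e Fin.≟ v) ⊎-dec (tgt e ∈? R ×-dec src e Fin.≟ v))

    expand : Subset n → Subset n
    expand R = Vec.tabulate (does ∘ λ v → v ∈? R ⊎-dec adjacent? R v)

    ∈-expand⁺ : ∀ {R v} → v ∈ R ⊎ Adjacent R v → v ∈ expand R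
    ∈-expand⁺ {R} = ∈-tabulate⁺ λ v → v ∈? R ⊎-dec adjacent? R v

    ∈-expand⁻ : ∀ {R v} → v ∈ expand R → v ∈ R ⊎ Adjacent R v
    ∈-expand⁻ {R} = ∈-tabulate⁻ λ v → v ∈? R ⊎-dec adjacent? R v

    ⊆-expand : ∀ R → R ⊆ expand R
    ⊆-expand R = ∈-expand⁺ ∘ inj₁

    expand-mono : ∀ {R S} → R ⊆ S → expand R ⊆ expand S
    expand-mono R⊆S v∈ with ∈-expand⁻ v∈
    ... | inj₁ v∈R = ∈-expand⁺ (inj₁ (R⊆S v∈R))
    ... | inj₂ (e , e∉H , inj₁ (s∈R , t≡v)) = ∈-expand⁺ (inj₂ (e , e∉H , inj₁ (R⊆S s∈R , t≡v)))
    ... | inj₂ (e , e∉H , inj₂ (t∈R , s≡v)) = ∈-expand⁺ (inj₂ (e , e∉H , inj₂ (R⊆S t∈R , s≡v)))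

    Closed : Subset n → Set
    Closed R = expand R ⊆ R

    Closed-Reach : ∀ {R} → Closed R → ∀ {u v} → u ∈ R → Reach H u v → v ∈ R
    Closed-Reach closed u∈R here = u∈R
    Closed-Reach closed u∈R (fwd e e∉H p) = Closed-Reach closed (closed (∈-expand⁺ (inj₂ (e , e∉H , inj₁ (u∈R , ≡.refl))))) p
    Closed-Reach closed u∈R (bwd e e∉H p) = Closed-Reach closed (closed (∈-expand⁺ (inj₂ (e , e∉H , inj₂ (u∈R , ≡.refl))))) p

    ⊂-expand : ∀ R → ¬ Closed R → R ⊂ expand R
    ⊂-expand R notClosed with FinP.¬∀⟶∃¬ n (λ v → v ∈ expand R → v ∈ R) (λ v → v ∈? expand R →-dec v ∈? R) (λ closed → notClosed (closed _))
    ... | v , v∉ with v ∈? expand R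
    ...   | yes v∈ = ⊆-expand R , v , v∈ , λ v∈R → v∉ λ _ → v∈R
    ...   | no v∉′ = contradiction (λ v∈ → contradiction v∈ v∉′) v∉

    reachedWithin : Fin n → ℕ → Subset n
    reachedWithin u zero    = ⁅ u ⁆
    reachedWithin u (suc k) = expand (reachedWithin u k)

    ∈-reachedWithin : ∀ u k → u ∈ reachedWithin u k
    ∈-reachedWithin u zero    = SubsetP.x∈⁅x⁆ u
    ∈-reachedWithin u (suc k) = ⊆-expand _ (∈-reachedWithin u k)

    reachedWithin-Reach : ∀ u k {v} → v ∈ reachedWithin u k → Reach H u v
    reachedWithin-Reach u zero v∈ with SubsetP.x∈⁅y⁆⇒x≡y u v∈
    ... | ≡.refl = here
    reachedWithin-Reach u (suc k) v∈ with ∈-expand⁻ v∈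
    ... | inj₁ v∈R = reachedWithin-Reach u k v∈R
    ... | inj₂ (e , e∉H , inj₁ (s∈R , ≡.refl)) = Reach-trans (reachedWithin-Reach u k s∈R) (fwd e e∉H here)
    ... | inj₂ (e , e∉H , inj₂ (t∈R , ≡.refl)) = Reach-trans (reachedWithin-Reach u k t∈R) (bwd e e∉H here)

    closed-or-large : ∀ u k → Closed (reachedWithin u k) ⊎ k ℕ.< ∣ reachedWithin u k ∣
    closed-or-large u zero = inj₂ (ℕP.≤-reflexive (≡.sym (SubsetP.∣⁅x⁆∣≡1 u)))
    closed-or-large u (suc k) with closed-or-large u k | reachedWithin u (suc k) ⊆? reachedWithin u k
    ... | inj₁ closed | _ = inj₁ (expand-mono closed)
    ... | inj₂ _ | yes closed = inj₁ (expand-mono closed)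
    ... | inj₂ large | no notClosed = inj₂ (ℕP.≤-trans (ℕ.s≤s large) (SubsetP.p⊂q⇒∣p∣<∣q∣ (⊂-expand _ notClosed)))

    closed-after-n : ∀ u → Closed (reachedWithin u n)
    closed-after-n u with closed-or-large u n
    ... | inj₁ closed = closed
    ... | inj₂ large = contradiction (SubsetP.∣p∣≤n (reachedWithin u n)) (ℕP.<⇒≱ large)

    reach? : ∀ u v → Dec (Reach H u v)
    reach? u v with v ∈? reachedWithin u n
    ... | yes v∈ = yes (reachedWithin-Reach u n v∈)
    ... | no v∉  = no λ p → v∉ (Closed-Reach (closed-after-n u) (∈-reachedWithin u n) p)

  slim? : ∀ H → Dec (Slim H)
  slim? H = FinP.all? λ i → FinP.all? λ j → ReachableSet.reach? H i j

module SlimCoefficients {c ℓ : Level} (K : Field c ℓ) {n m : ℕ} (t : Fin n → Fin m) where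
  open Field K
  open FieldProperties K using (if-does-≈)
  open CompleteTiered K t
  open Reachability K t
  open Sums K
  open import Relation.Binary.Reasoning.Setoid setoid
  open GroupProperties +-group using (x∙y⁻¹≈ε⇒x≈y; x≈y⇒x∙y⁻¹≈ε)

  φ-diag : ∀ H → φ H H ≈ 1#
  φ-diag H = reflexive (≡.cong (if_then 1# else 0#) (dec-true (≡-dec BoolP._≟_ H H) ≡.refl))

  φ-offdiag : ∀ {H S} → S ≢ H → φ H S ≈ 0#
  φ-offdiag {H} {S} S≢H = reflexive (≡.cong (if_then 1# else 0#) (dec-false (≡-dec BoolP._≟_ S H) S≢H))

  *Λ-supportedˡ : ∀ {F} T₀ → (∀ T → T ≢ T₀ → F T ≈ 0#) → ∀ G S →
                  (F *Λ G) S ≈ (if does (T₀ ⊆? S) then F T₀ * G (S ─ T₀) else 0#)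
  *Λ-supportedˡ {F} T₀ F≈0 G S = ∑ᴸ-allSubsets-δ _ T₀ term≈0
    where
    term≈0 : ∀ T → T ≢ T₀ → (if does (T ⊆? S) then F T * G (S ─ T) else 0#) ≈ 0#
    term≈0 T T≢T₀ with does (T ⊆? S)
    ... | true  = trans (*-congʳ (F≈0 T T≢T₀)) (zeroˡ _)
    ... | false = refl

  ·1Λ-*Λ-φ : ∀ a H S → ((a ·Λ 1Λ) *Λ φ H) S ≈ a * φ H S
  ·1Λ-*Λ-φ a H S = begin
    ((a ·Λ 1Λ) *Λ φ H) S                                           ≈⟨ *Λ-supportedˡ ∅ (λ T T≢∅ → trans (*-congˡ (φ-offdiag T≢∅)) (zeroʳ a)) (φ H) S ⟩
    (if does (∅ ⊆? S) then a * φ ∅ ∅ * φ H (S ─ ∅) else 0#)       ≡⟨ ≡.cong (if_then a * φ ∅ ∅ * φ H (S ─ ∅) else 0#) (dec-true (∅ ⊆? S) SubsetP.⊥⊆) ⟩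
    a * φ ∅ ∅ * φ H (S ─ ∅)                                        ≈⟨ *-cong (trans (*-congˡ (φ-diag ∅)) (*-identityʳ a)) (reflexive (≡.cong (φ H) (SubsetP.p─⊥≡p S))) ⟩
    a * φ H S                                                      ∎

  IdealSum : List (Λ × Subgraph) → Λ
  IdealSum = List.foldr (λ q acc → (proj₁ q *Λ φ (proj₂ q)) +Λ acc) 0Λ

  IdealSum-vanishesOnSlim : ∀ l → All (λ q → ¬ Slim (proj₂ q)) l → ∀ {S} → Slim S → IdealSum l S ≈ 0#
  IdealSum-vanishesOnSlim []             []                 slim = refl
  IdealSum-vanishesOnSlim ((q , H) ∷ l) (H-nonSlim ∷ rest) {S} slim =
    trans (+-cong (∑ᴸ-≈0 (allSubsets N) term≈0) (IdealSum-vanishesOnSlim l rest slim)) (+-identityʳ 0#)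
    where
    term≈0 : ∀ T → (if does (T ⊆? S) then q T * φ H (S ─ T) else 0#) ≈ 0#
    term≈0 T with T ⊆? S
    ... | no _ = refl
    ... | yes _ with ≡-dec BoolP._≟_ (S ─ T) H
    ...   | yes ≡.refl = contradiction (Slim-antitone (SubsetP.p─q⊆p S T) slim) H-nonSlim
    ...   | no _       = zeroʳ _

  vanishesOnSlim⇒InIdeal : ∀ {f} → (∀ {S} → Slim S → f S ≈ 0#) → InIdeal f
  vanishesOnSlim⇒InIdeal {f} f≈0 = List.map generator nonSlims , AllP.map⁺ (AllP.all-filter nonSlim? (allSubsets N)) , f≈
    where
    nonSlim? : ∀ H → Dec (¬ Slim H)
    nonSlim? H = ¬? (slim? H)
    nonSlims : List Subgraph
    nonSlims = filter nonSlim? (allSubsets N)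
    generator : Subgraph → Λ × Subgraph
    generator H = f H ·Λ 1Λ , H
    δ-term : Subgraph → Subgraph → Carrier
    δ-term S H = if does (nonSlim? H) then f H * φ H S else 0#
    δ-term≈0 : ∀ S H → H ≢ S → δ-term S H ≈ 0#
    δ-term≈0 S H H≢S = if-does-≈ (nonSlim? H) (λ _ → trans (*-congˡ (φ-offdiag (H≢S ∘ ≡.sym))) (zeroʳ _)) (λ _ → refl)
    δ-term-diag : ∀ S → f S ≈ δ-term S S
    δ-term-diag S = sym (if-does-≈ (nonSlim? S) (λ _ → trans (*-congˡ (φ-diag S)) (*-identityʳ _))
                                              (λ ¬nonSlim → sym (f≈0 (decidable-stable (slim? S) ¬nonSlim))))
    f≈ : ∀ S → f S ≈ IdealSum (List.map generator nonSlims) S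
    f≈ S = begin
      f S                                                        ≈⟨ δ-term-diag S ⟩
      δ-term S S                                                 ≈⟨ ∑ᴸ-allSubsets-δ (δ-term S) S (δ-term≈0 S) ⟨
      ∑ᴸ (δ-term S) (allSubsets N)                               ≈⟨ ∑ᴸ-filter nonSlim? (λ H → f H * φ H S) (allSubsets N) ⟨
      ∑ᴸ (λ H → f H * φ H S) nonSlims                            ≈⟨ ∑ᴸ-cong nonSlims (λ H → ·1Λ-*Λ-φ (f H) H S) ⟨
      ∑ᴸ (λ H → ((f H ·Λ 1Λ) *Λ φ H) S) nonSlims                 ≡⟨ ∑ᴸ-map (λ q → (proj₁ q *Λ φ (proj₂ q)) S) generator nonSlims ⟨
      ∑ᴸ (λ q → (proj₁ q *Λ φ (proj₂ q)) S) (List.map generator nonSlims)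
                                                                 ≡⟨ foldr-+-at (λ q → proj₁ q *Λ φ (proj₂ q)) (List.map generator nonSlims) S ⟨
      IdealSum (List.map generator nonSlims) S                   ∎

  ≈Φ⇒≈-onSlim : ∀ {f g} → f ≈Φ g → ∀ {S} → Slim S → f S ≈ g S
  ≈Φ⇒≈-onSlim (l , nonSlim , f-g≈) slim = x∙y⁻¹≈ε⇒x≈y _ _ (trans (f-g≈ _) (IdealSum-vanishesOnSlim l nonSlim slim))

  ≈-onSlim⇒≈Φ : ∀ {f g} → (∀ {S} → Slim S → f S ≈ g S) → f ≈Φ g
  ≈-onSlim⇒≈Φ f≈g = vanishesOnSlim⇒InIdeal λ slim → x≈y⇒x∙y⁻¹≈ε (f≈g slim)

  X-at : ∀ i T → X i T ≡ ∑ᴸ (λ e → coef i e * φ ⁅ e ⁆ T) (allFin N)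
  X-at i = foldr-+-at (λ e → coef i e ·Λ φ ⁅ e ⁆) (allFin N)

  X-*Λ : ∀ i F S → (X i *Λ F) S ≈ ∑ᴸ (λ e → if does (e ∈? S) then coef i e * F (S ─ ⁅ e ⁆) else 0#) (allFin N)
  X-*Λ i F S = begin
    (X i *Λ F) S
      ≈⟨ ∑ᴸ-cong (allSubsets N) (λ T → expand (does (T ⊆? S)) T) ⟩
    ∑ᴸ (λ T → ∑ᴸ (λ e → if does (T ⊆? S) then coef i e * φ ⁅ e ⁆ T * F (S ─ T) else 0#) (allFin N)) (allSubsets N)
      ≈⟨ ∑ᴸ-comm (λ T e → if does (T ⊆? S) then coef i e * φ ⁅ e ⁆ T * F (S ─ T) else 0#) (allSubsets N) (allFin N) ⟩
    ∑ᴸ (λ e → ((coef i e ·Λ φ ⁅ e ⁆) *Λ F) S) (allFin N)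
      ≈⟨ ∑ᴸ-cong (allFin N) (λ e → *Λ-supportedˡ ⁅ e ⁆ (λ T T≢ → trans (*-congˡ (φ-offdiag T≢)) (zeroʳ _)) F S) ⟩
    ∑ᴸ (λ e → if does (⁅ e ⁆ ⊆? S) then coef i e * φ ⁅ e ⁆ ⁅ e ⁆ * F (S ─ ⁅ e ⁆) else 0#) (allFin N)
      ≈⟨ ∑ᴸ-cong (allFin N) (λ e → reflexive (≡.cong (λ b → if b then coef i e * φ ⁅ e ⁆ ⁅ e ⁆ * F (S ─ ⁅ e ⁆) else 0#)
                                                    (does-⇔ ⁅x⁆⊆⇔∈ (⁅ e ⁆ ⊆? S) (e ∈? S)))) ⟩
    ∑ᴸ (λ e → if does (e ∈? S) then coef i e * φ ⁅ e ⁆ ⁅ e ⁆ * F (S ─ ⁅ e ⁆) else 0#) (allFin N)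
      ≈⟨ ∑ᴸ-cong (allFin N) (λ e → drop-φ e (does (e ∈? S))) ⟩
    ∑ᴸ (λ e → if does (e ∈? S) then coef i e * F (S ─ ⁅ e ⁆) else 0#) (allFin N) ∎
    where
    expand : ∀ b T → (if b then X i T * F (S ─ T) else 0#) ≈
                     ∑ᴸ (λ e → if b then coef i e * φ ⁅ e ⁆ T * F (S ─ T) else 0#) (allFin N)
    expand true  T = trans (*-congʳ (reflexive (X-at i T))) (*-distribʳ-∑ᴸ _ _ (allFin N))
    expand false T = sym (∑ᴸ-≈0 (allFin N) λ _ → refl)
    drop-φ : ∀ e b → (if b then coef i e * φ ⁅ e ⁆ ⁅ e ⁆ * F (S ─ ⁅ e ⁆) else 0#) ≈
                     (if b then coef i e * F (S ─ ⁅ e ⁆) else 0#)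
    drop-φ e true  = *-congʳ (trans (*-congˡ (φ-diag ⁅ e ⁆)) (*-identityʳ _))
    drop-φ e false = refl

module Polynomials {c ℓ : Level} (K : Field c ℓ) {n m : ℕ} (t : Fin n → Fin m) where
  open Field K
  open CompleteTiered K t
  open Sums K
  open Integers K
  open IntegerCoefficients K using (solve; _:=_; _:+_; _:*_)
  open import Relation.Binary.Reasoning.Setoid setoid
  open GroupProperties +-group using (ε⁻¹≈ε)
  open RingProperties ring using (-1*x≈-x)

  Exponent : Set
  Exponent = Fin n → ℕ

  dec-self : ∀ a α → dec a α a ≡ α a ∸ 1
  dec-self a α with a Fin.≟ a
  ... | yes _   = ≡.refl
  ... | no a≢a = contradiction ≡.refl a≢a

  dec-other : ∀ {a j} α → j ≢ a → dec a α j ≡ α j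
  dec-other {a} {j} α j≢a with j Fin.≟ a
  ... | yes j≡a = contradiction j≡a j≢a
  ... | no _    = ≡.refl

  dec-cong : ∀ a {α β} → α ≗ β → dec a α ≗ dec a β
  dec-cong a α≗β j = ≡.cong (λ x → if does (j Fin.≟ a) then x ∸ 1 else x) (α≗β j)

  dec-inc : ∀ a β → dec a (inc a β) ≗ β
  dec-inc a β j with j Fin.≟ a
  ... | yes _ = ≡.refl
  ... | no _  = ≡.refl

  inc-dec : ∀ a β {k} → β a ≡ suc k → inc a (dec a β) ≗ β
  inc-dec a β βa≡ j with j Fin.≟ a
  ... | yes ≡.refl = ≡.trans (≡.cong (λ x → suc (x ∸ 1)) βa≡) (≡.sym βa≡)
  ... | no _       = ≡.refl

  inc-dec-comm : ∀ {i a} β → i ≢ a → inc i (dec a β) ≗ dec a (inc i β)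
  inc-dec-comm {i} {a} β i≢a j with j Fin.≟ i | j Fin.≟ a
  ... | yes ≡.refl | yes ≡.refl = contradiction ≡.refl i≢a
  ... | yes _      | no _       = ≡.refl
  ... | no _       | yes _      = ≡.refl
  ... | no _       | no _       = ≡.refl

  totalDeg≡∑ℕ : ∀ α → totalDeg α ≡ ∑ℕ α
  totalDeg≡∑ℕ α = foldr-tabulate (λ j → j)
    where
    foldr-tabulate : ∀ {d} (g : Fin d → Fin n) → List.foldr (λ i acc → α i ℕ.+ acc) 0 (List.tabulate g) ≡ ∑ℕ (α ∘ g)
    foldr-tabulate {zero}  g = ≡.refl
    foldr-tabulate {suc d} g = ≡.cong (α (g Fin.zero) ℕ.+_) (foldr-tabulate (g ∘ Fin.suc))

  totalDeg-cong : ∀ {α β} → α ≗ β → totalDeg α ≡ totalDeg β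
  totalDeg-cong {α} {β} α≗β = ≡.trans (totalDeg≡∑ℕ α) (≡.trans (MonoidSum.sum-cong-≗ ℕP.+-0-monoid α≗β) (≡.sym (totalDeg≡∑ℕ β)))

  totalDeg-inc : ∀ i α → totalDeg (inc i α) ≡ suc (totalDeg α)
  totalDeg-inc i α = ≡.trans (totalDeg≡∑ℕ (inc i α)) (≡.trans (∑ℕ-inc i α) (≡.cong suc (≡.sym (totalDeg≡∑ℕ α))))

  totalDeg-dec : ∀ a α {k} → α a ≡ suc k → totalDeg α ≡ suc (totalDeg (dec a α))
  totalDeg-dec a α αa≡ = ≡.trans (totalDeg≡∑ℕ α) (≡.trans (∑ℕ-dec a α αa≡) (≡.cong suc (≡.sym (totalDeg≡∑ℕ (dec a α)))))

  totalDeg-0 : totalDeg (λ _ → 0) ≡ 0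
  totalDeg-0 = ≡.trans (totalDeg≡∑ℕ _) (MonoidSum.sum-replicate-zero ℕP.+-0-monoid n)

  mulZ-at-0 : ∀ a p α → α a ≡ 0 → mulZ a p α ≡ 0#
  mulZ-at-0 a p α αa≡0 with α a
  ... | zero = ≡.refl

  mulZ-at-suc : ∀ a p α {k} → α a ≡ suc k → mulZ a p α ≡ p (dec a α)
  mulZ-at-suc a p α αa≡ with α a
  ... | suc _ = ≡.refl

  -- A polynomial is a function of the exponent vector; nothing forces it to respect pointwise equality.
  Extensional : Poly → Set ℓ
  Extensional p = ∀ {α β} → α ≗ β → p α ≈ p β

  Extensional-1P : Extensional 1P
  Extensional-1P α≗β = reflexive (≡.cong (λ d → if does (d ℕP.≟ 0) then 1# else 0#) (totalDeg-cong α≗β))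

  Extensional-mulZ : ∀ a {p} → Extensional p → Extensional (mulZ a p)
  Extensional-mulZ a p-ext {α} {β} α≗β with α a | β a | α≗β a
  ... | zero  | zero  | _ = refl
  ... | suc _ | suc _ | _ = p-ext (dec-cong a α≗β)

  Extensional-mulZe : ∀ e {p} → Extensional p → Extensional (mulZe e p)
  Extensional-mulZe e p-ext α≗β = +-cong (Extensional-mulZ (src e) p-ext α≗β) (*-congˡ (Extensional-mulZ (tgt e) p-ext α≗β))

  -- ZH H is ZL (allFin N) H; the list of edges is generalised for induction.
  ZL : List (Fin N) → Subgraph → Poly
  ZL L H = List.foldr (λ e acc → if does (e ∈? H) then mulZe e acc else acc) 1P L

  ZL-∅ : ∀ L → ZL L ∅ ≡ 1P
  ZL-∅ []      = ≡.refl
  ZL-∅ (e ∷ L) = ≡.trans (≡.cong (λ b → if b then mulZe e (ZL L ∅) else ZL L ∅) (dec-false (e ∈? ∅) SubsetP.∉⊥)) (ZL-∅ L)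

  Extensional-ZL : ∀ L H → Extensional (ZL L H)
  Extensional-ZL []      H = Extensional-1P
  Extensional-ZL (e ∷ L) H with does (e ∈? H)
  ... | true  = Extensional-mulZe e (Extensional-ZL L H)
  ... | false = Extensional-ZL L H

  HomogP-1P : HomogP 0 1P
  HomogP-1P α deg≢0 = reflexive (≡.cong (if_then 1# else 0#) (dec-false (totalDeg α ℕP.≟ 0) deg≢0))

  HomogP-mulZ : ∀ a {d p} → HomogP d p → HomogP (suc d) (mulZ a p)
  HomogP-mulZ a p-homog α deg≢ with α a in αa≡
  ... | zero  = refl
  ... | suc _ = p-homog (dec a α) λ deg≡ → deg≢ (≡.trans (totalDeg-dec a α αa≡) (≡.cong suc deg≡))

  HomogP-mulZe : ∀ e {d p} → HomogP d p → HomogP (suc d) (mulZe e p)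
  HomogP-mulZe e p-homog α deg≢ =
    trans (+-cong (HomogP-mulZ (src e) p-homog α deg≢) (*-congˡ (HomogP-mulZ (tgt e) p-homog α deg≢)))
          (trans (+-identityˡ _) (zeroʳ _))

  HomogP-ZL : ∀ L H → HomogP (List.length (filter (_∈? H) L)) (ZL L H)
  HomogP-ZL []      H = HomogP-1P
  HomogP-ZL (e ∷ L) H with does (e ∈? H)
  ... | true  = HomogP-mulZe e (HomogP-ZL L H)
  ... | false = HomogP-ZL L H

  HomogP-ZH : ∀ H → HomogP ∣ H ∣ (ZH H)
  HomogP-ZH H α deg≢ = HomogP-ZL (allFin N) H α (deg≢ ∘ λ deg≡ → ≡.trans deg≡ (≡.sym (∣∣≡length-filter H)))

  integral-ZL : ∀ L H α → Integral (ZL L H α)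
  integral-ZL [] H α with isZeroExp α
  ... | true  = integral-1#
  ... | false = integral-0#
  integral-ZL (e ∷ L) H α with does (e ∈? H)
  ... | true  = integral-+ (integral-mulZ (src e)) (integral-* (integral-neg integral-1#) (integral-mulZ (tgt e)))
    where
    integral-mulZ : ∀ a → Integral (mulZ a (ZL L H) α)
    integral-mulZ a with α a
    ... | zero  = integral-0#
    ... | suc _ = integral-ZL L H (dec a α)
  ... | false = integral-ZL L H α

  mulZ-cong : ∀ a {p q : Poly} → (∀ γ → p γ ≈ q γ) → ∀ β → mulZ a p β ≈ mulZ a q β
  mulZ-cong a p≈q β with β a
  ... | zero  = refl
  ... | suc _ = p≈q _

  mulZe-cong : ∀ e {p q : Poly} → (∀ γ → p γ ≈ q γ) → ∀ β → mulZe e p β ≈ mulZe e q β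
  mulZe-cong e p≈q β = +-cong (mulZ-cong (src e) p≈q β) (*-congˡ (mulZ-cong (tgt e) p≈q β))

  module _ {a} {A : Set a} (L : List A) (b : A → Bool) (c : A → Carrier) (q : A → Poly) where
    mulZ-∑ᴸ : ∀ v β → mulZ v (λ γ → ∑ᴸ (λ x → if b x then c x * q x γ else 0#) L) β ≈
                      ∑ᴸ (λ x → if b x then c x * mulZ v (q x) β else 0#) L
    mulZ-∑ᴸ v β with β v
    ... | zero  = sym (∑ᴸ-≈0 L λ x → masked-zero (b x))
      where
      masked-zero : ∀ b′ {x} → (if b′ then c x * 0# else 0#) ≈ 0#
      masked-zero true  = zeroʳ _
      masked-zero false = refl
    ... | suc _ = refl

    mulZe-∑ᴸ : ∀ e β → mulZe e (λ γ → ∑ᴸ (λ x → if b x then c x * q x γ else 0#) L) β ≈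
                       ∑ᴸ (λ x → if b x then c x * mulZe e (q x) β else 0#) L
    mulZe-∑ᴸ e β = begin
      mulZ (src e) _ β + - 1# * mulZ (tgt e) _ β
        ≈⟨ +-cong (mulZ-∑ᴸ (src e) β) (*-congˡ (mulZ-∑ᴸ (tgt e) β)) ⟩
      ∑ᴸ (masked (src e)) L + - 1# * ∑ᴸ (masked (tgt e)) L
        ≈⟨ +-congˡ (*-distribˡ-∑ᴸ (- 1#) (masked (tgt e)) L) ⟩
      ∑ᴸ (masked (src e)) L + ∑ᴸ (λ x → - 1# * masked (tgt e) x) L
        ≈⟨ ∑ᴸ-distrib-+ (masked (src e)) (λ x → - 1# * masked (tgt e) x) L ⟨
      ∑ᴸ (λ x → masked (src e) x + - 1# * masked (tgt e) x) L
        ≈⟨ ∑ᴸ-cong L (λ x → combine (b x)) ⟩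
      ∑ᴸ (λ x → if b x then c x * mulZe e (q x) β else 0#) L ∎
      where
      masked : Fin n → A → Carrier
      masked v x = if b x then c x * mulZ v (q x) β else 0#
      combine : ∀ b′ {x} → (if b′ then c x * mulZ (src e) (q x) β else 0#) + - 1# * (if b′ then c x * mulZ (tgt e) (q x) β else 0#)
                         ≈ (if b′ then c x * mulZe e (q x) β else 0#)
      combine true  = solve 4 (λ c u w v → c :* u :+ w :* (c :* v) := c :* (u :+ w :* v)) refl _ _ _ _
      combine false = trans (+-congˡ (zeroʳ _)) (+-identityʳ 0#)

  -- The coefficient of z^β in ∂p/∂zᵢ is (βᵢ + 1) · p_{β + eᵢ}.
  ∂ : Fin n → Poly → Poly
  ∂ i p β = ofℕ K (suc (β i)) * p (inc i β)

  δ : Fin n → Fin n → Carrier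
  δ i a = if does (i Fin.≟ a) then 1# else 0#

  ∂-1P : ∀ i β → ∂ i 1P β ≈ 0#
  ∂-1P i β = trans (*-congˡ (HomogP-1P (inc i β) λ deg≡0 → ℕP.1+n≢0 (≡.trans (≡.sym (totalDeg-inc i β)) deg≡0))) (zeroʳ _)

  ∂-mulZ-self : ∀ i {p} → Extensional p → ∀ β → ∂ i (mulZ i p) β ≈ p β + mulZ i (∂ i p) β
  ∂-mulZ-self i {p} p-ext β = begin
    ofℕ K (suc (β i)) * mulZ i p (inc i β)  ≡⟨ ≡.cong (ofℕ K (suc (β i)) *_) (mulZ-at-suc i p (inc i β) (inc-self i β)) ⟩
    ofℕ K (suc (β i)) * p (dec i (inc i β)) ≈⟨ *-congˡ (p-ext (dec-inc i β)) ⟩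
    (1# + ofℕ K (β i)) * p β                ≈⟨ distribʳ _ _ _ ⟩
    1# * p β + ofℕ K (β i) * p β            ≈⟨ +-cong (*-identityˡ _) (lower (β i) ≡.refl) ⟩
    p β + mulZ i (∂ i p) β                  ∎
    where
    lower : ∀ k → β i ≡ k → ofℕ K k * p β ≈ mulZ i (∂ i p) β
    lower zero    βi≡0 = trans (zeroˡ _) (sym (reflexive (mulZ-at-0 i (∂ i p) β βi≡0)))
    lower (suc k) βi≡  = begin
      ofℕ K (suc k) * p β                           ≈⟨ *-cong (reflexive (≡.cong (ofℕ K ∘ suc) (≡.sym dec-βi))) (p-ext (≡.sym ∘ inc-dec i β βi≡)) ⟩
      ofℕ K (suc (dec i β i)) * p (inc i (dec i β))  ≡⟨ mulZ-at-suc i (∂ i p) β βi≡ ⟨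
      mulZ i (∂ i p) β                              ∎
      where
      dec-βi : dec i β i ≡ k
      dec-βi = ≡.trans (dec-self i β) (≡.cong (_∸ 1) βi≡)

  ∂-mulZ-other : ∀ {i a} {p} → Extensional p → i ≢ a → ∀ β → ∂ i (mulZ a p) β ≈ mulZ a (∂ i p) β
  ∂-mulZ-other {i} {a} {p} p-ext i≢a β = shift (β a) ≡.refl
    where
    incβa≡ : inc i β a ≡ β a
    incβa≡ = inc-other β (i≢a ∘ ≡.sym)
    shift : ∀ k → β a ≡ k → ∂ i (mulZ a p) β ≈ mulZ a (∂ i p) β
    shift zero    βa≡0 = trans (*-congˡ (reflexive (mulZ-at-0 a p (inc i β) (≡.trans incβa≡ βa≡0))))
                               (trans (zeroʳ _) (sym (reflexive (mulZ-at-0 a (∂ i p) β βa≡0))))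
    shift (suc k) βa≡  = begin
      ofℕ K (suc (β i)) * mulZ a p (inc i β)          ≡⟨ ≡.cong (ofℕ K (suc (β i)) *_) (mulZ-at-suc a p (inc i β) (≡.trans incβa≡ βa≡)) ⟩
      ofℕ K (suc (β i)) * p (dec a (inc i β))         ≈⟨ *-cong (reflexive (≡.cong (ofℕ K ∘ suc) (≡.sym (dec-other β i≢a))))
                                                                (p-ext (≡.sym ∘ inc-dec-comm β i≢a)) ⟩
      ofℕ K (suc (dec a β i)) * p (inc i (dec a β))   ≡⟨ mulZ-at-suc a (∂ i p) β βa≡ ⟨
      mulZ a (∂ i p) β                                ∎

  ∂-mulZ : ∀ i a {p} → Extensional p → ∀ β → ∂ i (mulZ a p) β ≈ δ i a * p β + mulZ a (∂ i p) β
  ∂-mulZ i a p-ext β with i Fin.≟ a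
  ... | yes ≡.refl = trans (∂-mulZ-self i p-ext β) (+-congʳ (sym (*-identityˡ _)))
  ... | no i≢a     = trans (∂-mulZ-other p-ext i≢a β) (sym (trans (+-congʳ (zeroˡ _)) (+-identityˡ _)))

  src<tgt : ∀ e → src e Fin.< tgt e
  src<tgt e = proj₁ (proj₂ (∈ᴸP.∈-filter⁻ (λ p → (proj₁ p Fin.<? proj₂ p) ×-dec (t (proj₁ p) Fin.<? t (proj₂ p)))
                              {xs = List.cartesianProduct (allFin n) (allFin n)} (∈ᴸP.∈-lookup {xs = edgeList} e)))

  coef≈δ-δ : ∀ i e → coef i e ≈ δ i (src e) - δ i (tgt e)
  coef≈δ-δ i e with i Fin.≟ src e | i Fin.≟ tgt e
  ... | yes ≡.refl | yes i≡tgt = contradiction i≡tgt (FinP.<⇒≢ (src<tgt e))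
  ... | yes _      | no _      = sym (trans (+-congˡ ε⁻¹≈ε) (+-identityʳ 1#))
  ... | no _       | yes _     = sym (+-identityˡ _)
  ... | no _       | no _      = sym (trans (+-congˡ ε⁻¹≈ε) (+-identityʳ 0#))

  ∂-mulZe : ∀ i e {p} → Extensional p → ∀ β → ∂ i (mulZe e p) β ≈ coef i e * p β + mulZe e (∂ i p) β
  ∂-mulZe i e {p} p-ext β = begin
    w * (mulZ s p (inc i β) + - 1# * mulZ t′ p (inc i β))
      ≈⟨ solve 4 (λ w u m v → w :* (u :+ m :* v) := w :* u :+ m :* (w :* v)) refl w _ (- 1#) _ ⟩
    ∂ i (mulZ s p) β + - 1# * ∂ i (mulZ t′ p) β
      ≈⟨ +-cong (∂-mulZ i s p-ext β) (*-congˡ (∂-mulZ i t′ p-ext β)) ⟩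
    (δ i s * p β + mulZ s (∂ i p) β) + - 1# * (δ i t′ * p β + mulZ t′ (∂ i p) β)
      ≈⟨ solve 6 (λ ds dt m x u v → (ds :* x :+ u) :+ m :* (dt :* x :+ v) := (ds :+ m :* dt) :* x :+ (u :+ m :* v)) refl (δ i s) (δ i t′) (- 1#) (p β) _ _ ⟩
    (δ i s + - 1# * δ i t′) * p β + mulZe e (∂ i p) β
      ≈⟨ +-congʳ (*-congʳ (trans (+-congˡ (-1*x≈-x _)) (sym (coef≈δ-δ i e)))) ⟩
    coef i e * p β + mulZe e (∂ i p) β ∎
    where
    w = ofℕ K (suc (β i))
    s = src e
    t′ = tgt e

  ZL-cong-∈ : ∀ {L H₁ H₂} → All (λ e → does (e ∈? H₁) ≡ does (e ∈? H₂)) L → ZL L H₁ ≡ ZL L H₂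
  ZL-cong-∈ []                = ≡.refl
  ZL-cong-∈ {e ∷ L} (e∈≡ ∷ rest) = ≡.cong₂ (λ b z → if b then mulZe e z else z) e∈≡ (ZL-cong-∈ rest)

  ∂-ZL : ∀ {L} → Unique L → ∀ i H β →
         ∂ i (ZL L H) β ≈ ∑ᴸ (λ e → if does (e ∈? H) then coef i e * ZL L (H ─ ⁅ e ⁆) β else 0#) L
  ∂-ZL []                               i H β = ∂-1P i β
  ∂-ZL {e′ ∷ L} (e′≢L ∷ unique) i H β = begin
    ∂ i (ZL (e′ ∷ L) H) β
      ≈⟨ split (does (e′ ∈? H)) ⟩
    (if does (e′ ∈? H) then coef i e′ * P β else 0#) +
    ∑ᴸ (λ e → if does (e ∈? H) then coef i e * step (does (e′ ∈? H)) (Q e) β else 0#) L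
      ≈⟨ +-cong (reflexive (≡.cong (λ p → if does (e′ ∈? H) then coef i e′ * p β else 0#) (≡.sym removeHead)))
                (∑ᴸ-congᴬ (All.map (λ {e} e′≢e → reflexive (≡.cong (λ p → if does (e ∈? H) then coef i e * p β else 0#)
                                                                      (≡.sym (removeOther e′≢e)))) e′≢L)) ⟩
    ∑ᴸ (λ e → if does (e ∈? H) then coef i e * ZL (e′ ∷ L) (H ─ ⁅ e ⁆) β else 0#) (e′ ∷ L) ∎
    where
    P = ZL L H
    Q : Fin N → Poly
    Q e = ZL L (H ─ ⁅ e ⁆)
    step : Bool → Poly → Poly
    step b p = if b then mulZe e′ p else p
    ∂P≈ : ∀ γ → ∂ i P γ ≈ ∑ᴸ (λ e → if does (e ∈? H) then coef i e * Q e γ else 0#) L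
    ∂P≈ = ∂-ZL unique i H
    split : ∀ b → ∂ i (step b P) β ≈
            (if b then coef i e′ * P β else 0#) + ∑ᴸ (λ e → if does (e ∈? H) then coef i e * step b (Q e) β else 0#) L
    split true  = begin
      ∂ i (mulZe e′ P) β                        ≈⟨ ∂-mulZe i e′ (Extensional-ZL L H) β ⟩
      coef i e′ * P β + mulZe e′ (∂ i P) β      ≈⟨ +-congˡ (mulZe-cong e′ ∂P≈ β) ⟩
      coef i e′ * P β + mulZe e′ (λ γ → ∑ᴸ (λ e → if does (e ∈? H) then coef i e * Q e γ else 0#) L) β
                                                ≈⟨ +-congˡ (mulZe-∑ᴸ L (λ e → does (e ∈? H)) (coef i) Q e′ β) ⟩
      coef i e′ * P β + ∑ᴸ (λ e → if does (e ∈? H) then coef i e * mulZe e′ (Q e) β else 0#) L ∎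
    split false = trans (∂P≈ β) (sym (+-identityˡ _))
    removeHead : ZL (e′ ∷ L) (H ─ ⁅ e′ ⁆) ≡ P
    removeHead = ≡.trans (≡.cong (λ b → step b (ZL L (H ─ ⁅ e′ ⁆))) (∈-─⁅⁆-self H e′))
                         (ZL-cong-∈ (All.map (∈-─⁅⁆-other H) e′≢L))
    removeOther : ∀ {e} → e′ ≢ e → ZL (e′ ∷ L) (H ─ ⁅ e ⁆) ≡ step (does (e′ ∈? H)) (Q e)
    removeOther e′≢e = ≡.cong (λ b → step b _) (∈-─⁅⁆-other H (e′≢e ∘ ≡.sym))

  ∂-ZH : ∀ i H β → ∂ i (ZH H) β ≈ ∑ᴸ (λ e → if does (e ∈? H) then coef i e * ZH (H ─ ⁅ e ⁆) β else 0#) (allFin N)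
  ∂-ZH = ∂-ZL (UniqueP.allFin⁺ N)

module Words {c ℓ : Level} (K : Field c ℓ) {n m : ℕ} (t : Fin n → Fin m) where
  open Field K
  open CompleteTiered K t
  open Polynomials K t

  count : List (Fin n) → Exponent
  count []      = λ _ → 0
  count (i ∷ w) = inc i (count w)

  totalDeg-count : ∀ w → totalDeg (count w) ≡ List.length w
  totalDeg-count []      = totalDeg-0
  totalDeg-count (i ∷ w) = ≡.trans (totalDeg-inc i (count w)) (≡.cong suc (totalDeg-count w))

  zero-or-positive : ∀ (α : Exponent) → (∀ j → α j ≡ 0) ⊎ ∃ λ a → ∃ λ l → α a ≡ suc l
  zero-or-positive α with FinP.any? (λ a → ¬? (α a ℕP.≟ 0))
  ... | no none = inj₁ λ j → decidable-stable (α j ℕP.≟ 0) λ αj≢0 → none (j , αj≢0)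
  ... | yes (a , αa≢0) with α a in αa≡
  ...   | zero  = contradiction ≡.refl αa≢0
  ...   | suc l = inj₂ (a , l , αa≡)

  wordWithCount : ∀ k α → totalDeg α ≡ k → Σ (List (Fin n)) λ w → List.length w ≡ k × count w ≗ α
  wordWithCount k α deg≡ with zero-or-positive α
  ... | inj₁ α≗0 = [] , ≡.trans (≡.sym (≡.trans (totalDeg-cong α≗0) totalDeg-0)) deg≡ , ≡.sym ∘ α≗0
  ... | inj₂ (a , l , αa≡) with k | ≡.trans (≡.sym (totalDeg-dec a α αa≡)) deg≡
  -- k = 0 is impossible, as then deg-dec≡ : suc _ ≡ 0.
  ...   | suc k′ | deg-dec≡ =
          let (w , len , cnt) = wordWithCount k′ (dec a α) (ℕP.suc-injective deg-dec≡)
          in a ∷ w , ≡.cong suc len , λ j → ≡.trans (inc-cong a cnt j) (inc-dec a α αa≡ j)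

  words : ℕ → List (List (Fin n))
  words zero    = [] ∷ []
  words (suc k) = List.cartesianProductWith _∷_ (allFin n) (words k)

  ∈-words⁻ : ∀ k {w} → w ∈ᴸ words k → List.length w ≡ k
  ∈-words⁻ zero    (Any.here ≡.refl) = ≡.refl
  ∈-words⁻ (suc k) w∈ with ∈ᴸP.∈-cartesianProductWith⁻ _∷_ (allFin n) (words k) w∈
  ... | i , w′ , _ , w′∈ , ≡.refl = ≡.cong suc (∈-words⁻ k w′∈)

  ∈-words⁺ : ∀ w → w ∈ᴸ words (List.length w)
  ∈-words⁺ []      = Any.here ≡.refl
  ∈-words⁺ (i ∷ w) = ∈ᴸP.∈-cartesianProductWith⁺ _∷_ (∈ᴸP.∈-allFin i) (∈-words⁺ w)

module ProductsOfX {c ℓ : Level} (K : Field c ℓ) {n m : ℕ} (t : Fin n → Fin m) where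
  open Field K
  open FieldProperties K
  open CompleteTiered K t
  open Sums K
  open SlimCoefficients K t
  open Polynomials K t
  open Words K t
  open IntegerCoefficients K using (solve; _:=_; _:*_)
  open import Relation.Binary.Reasoning.Setoid setoid

  -- count! w = ∏ⱼ (count w j)!
  count! : List (Fin n) → Carrier
  count! []      = 1#
  count! (i ∷ w) = ofℕ K (suc (count w i)) * count! w

  count!≉0 : CharacteristicZero K → ∀ w → ¬ count! w ≈ 0#
  count!≉0 char0 []      = 1≉0
  count!≉0 char0 (i ∷ w) = *-≉0 (char0 (count w i)) (count!≉0 char0 w)

  1Λ≈ZH-at-0 : ∀ S → 1Λ S ≈ ZH S (λ _ → 0)
  1Λ≈ZH-at-0 S with ≡-dec BoolP._≟_ S ∅
  ... | yes ≡.refl = sym (reflexive (≡.trans (≡.cong (λ p → p (λ _ → 0)) (ZL-∅ (allFin N)))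
                                             (≡.cong (if_then 1# else 0#) (dec-true (totalDeg (λ _ → 0) ℕP.≟ 0) totalDeg-0))))
  ... | no S≢∅     = sym (HomogP-ZH S (λ _ → 0) λ 0≡∣S∣ → S≢∅ (∣∣≡0⇒≡∅ S (≡.trans (≡.sym 0≡∣S∣) totalDeg-0)))

  prodX-at : ∀ w S → prodX w S ≈ count! w * ZH S (count w)
  prodX-at []      S = trans (1Λ≈ZH-at-0 S) (sym (*-identityˡ _))
  prodX-at (i ∷ w) S = begin
    (X i *Λ prodX w) S
      ≈⟨ X-*Λ i (prodX w) S ⟩
    ∑ᴸ (λ e → if does (e ∈? S) then coef i e * prodX w (S ─ ⁅ e ⁆) else 0#) (allFin N)
      ≈⟨ ∑ᴸ-cong (allFin N) (λ e → factor e (does (e ∈? S))) ⟩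
    ∑ᴸ (λ e → count! w * (if does (e ∈? S) then coef i e * ZH (S ─ ⁅ e ⁆) (count w) else 0#)) (allFin N)
      ≈⟨ *-distribˡ-∑ᴸ (count! w) _ (allFin N) ⟨
    count! w * ∑ᴸ (λ e → if does (e ∈? S) then coef i e * ZH (S ─ ⁅ e ⁆) (count w) else 0#) (allFin N)
      ≈⟨ *-congˡ (∂-ZH i S (count w)) ⟨
    count! w * (ofℕ K (suc (count w i)) * ZH S (inc i (count w)))
      ≈⟨ solve 3 (λ f a z → f :* (a :* z) := a :* f :* z) refl (count! w) _ _ ⟩
    count! (i ∷ w) * ZH S (count (i ∷ w)) ∎
    where
    factor : ∀ e b → (if b then coef i e * prodX w (S ─ ⁅ e ⁆) else 0#) ≈
                     count! w * (if b then coef i e * ZH (S ─ ⁅ e ⁆) (count w) else 0#)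
    factor e true  = trans (*-congˡ (prodX-at w (S ─ ⁅ e ⁆)))
                           (solve 3 (λ a f z → a :* (f :* z) := f :* (a :* z)) refl (coef i e) (count! w) _)
    factor e false = sym (zeroʳ _)

  prodX-homogeneous : ∀ w S → ∣ S ∣ ≢ List.length w → prodX w S ≈ 0#
  prodX-homogeneous w S ∣S∣≢ = trans (prodX-at w S) (trans (*-congˡ (HomogP-ZH S (count w)
    λ deg≡ → ∣S∣≢ (≡.trans (≡.sym deg≡) (totalDeg-count w)))) (zeroʳ _))

module Coordinates {c ℓ : Level} (K : Field c ℓ) {X : Set} {d : ℕ} (b : Fin d → X → Field.Carrier K) where
  open Field K
  open Sums K
  open SemiringSum semiring using (sum; sum-cong-≋; *-distribˡ-sum; ∑-distrib-+)
  open IntegerCoefficients K using (solve; _:=_; _:+_; _:*_)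
  open import Relation.Binary.Reasoning.Setoid setoid

  comb-at : ∀ (y : Fin d → Carrier) x →
            List.foldr (λ s acc z → y s * b s z + acc z) (λ _ → 0#) (allFin d) x ≡ sum (λ s → y s * b s x)
  comb-at y x = ≡.trans (foldr-+-at (λ s z → y s * b s z) (allFin d) x) (∑ᴸ-allFin (λ s → y s * b s x))

  HasCoordinates : ∀ {t} → (X → Set t) → (X → Carrier) → Set _
  HasCoordinates T v = Σ (Fin d → Carrier) λ y → ∀ {x} → T x → v x ≈ sum (λ s → y s * b s x)

  lincomb-HasCoordinates : ∀ {t} {T : X → Set t} (L : List (Carrier × (X → Carrier))) →
    All (HasCoordinates T ∘ proj₂) L → HasCoordinates T (λ x → ∑ᴸ (λ q → proj₁ q * proj₂ q x) L)
  lincomb-HasCoordinates [] [] = (λ _ → 0#) , λ {x} _ → sym (sum-≈0 λ s → zeroˡ (b s x))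
  lincomb-HasCoordinates ((a , v) ∷ L) ((y , v≈) ∷ rest) =
    let (y′ , L≈) = lincomb-HasCoordinates L rest in
    (λ s → a * y s + y′ s) , λ {x} Tx → begin
      a * v x + ∑ᴸ (λ q → proj₁ q * proj₂ q x) L
        ≈⟨ +-cong (*-congˡ (v≈ Tx)) (L≈ Tx) ⟩
      a * sum (λ s → y s * b s x) + sum (λ s → y′ s * b s x)
        ≈⟨ +-congʳ (*-distribˡ-sum a (λ s → y s * b s x)) ⟩
      sum (λ s → a * (y s * b s x)) + sum (λ s → y′ s * b s x)
        ≈⟨ ∑-distrib-+ (λ s → a * (y s * b s x)) (λ s → y′ s * b s x) ⟨
      sum (λ s → a * (y s * b s x) + y′ s * b s x)
        ≈⟨ sum-cong-≋ (λ s → solve 4 (λ a y y′ z → a :* (y :* z) :+ y′ :* z := (a :* y :+ y′) :* z) refl a (y s) (y′ s) (b s x)) ⟩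
      sum (λ s → (a * y s + y′ s) * b s x) ∎

module DimensionEquality {c ℓ : Level} (K : Field c ℓ) (char0 : CharacteristicZero K)
                         {n m : ℕ} (t : Fin n → Fin m) (k : ℕ) where
  open Field K
  open FieldProperties K
  open CompleteTiered K t
  open Sums K
  open Integers K
  open Reachability K t using (slim?)
  open SlimCoefficients K t
  open Polynomials K t
  open Words K t
  open ProductsOfX K t
  open GaussianElimination K
  open SemiringSum semiring using (sum; sum-cong-≋; *-distribˡ-sum)
  open IntegerCoefficients K using (solve; _:=_; _:*_)
  open import Relation.Binary.Reasoning.Setoid setoid

  SlimWithKEdges : Subgraph → Set
  SlimWithKEdges H = Slim H × ∣ H ∣ ≡ k

  slimWithKEdges? : ∀ H → Dec (SlimWithKEdges H)
  slimWithKEdges? H = slim? H ×-dec (∣ H ∣ ℕP.≟ k)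

  rows : List Subgraph
  rows = filter slimWithKEdges? (allSubsets N)

  row : Fin (List.length rows) → Subgraph
  row = List.lookup rows

  row-slimWithKEdges : ∀ ρ → SlimWithKEdges (row ρ)
  row-slimWithKEdges ρ = proj₂ (∈ᴸP.∈-filter⁻ slimWithKEdges? {xs = allSubsets N} (∈ᴸP.∈-lookup ρ))

  row-complete : ∀ {H} → SlimWithKEdges H → ∃ λ ρ → row ρ ≡ H
  row-complete {H} H-slimWithKEdges = Any.index H∈ , ≡.sym (AnyP.lookup-index H∈)
    where H∈ = ∈ᴸP.∈-filter⁺ slimWithKEdges? (∈-allSubsets H) H-slimWithKEdges

  col : Fin (List.length (words k)) → List (Fin n)
  col = List.lookup (words k)

  col-length : ∀ c → List.length (col c) ≡ k
  col-length c = ∈-words⁻ k (∈ᴸP.∈-lookup c)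

  col-complete : ∀ {w} → List.length w ≡ k → ∃ λ c → col c ≡ w
  col-complete {w} ≡.refl = Any.index w∈ , ≡.sym (AnyP.lookup-index w∈)
    where w∈ = ∈-words⁺ w

  col-for : ∀ {α} → totalDeg α ≡ k → ∃ λ c → count (col c) ≗ α
  col-for {α} deg≡ =
    let (w , len , count≗) = wordWithCount k α deg≡
        (c , col≡) = col-complete {w} len
    in c , λ j → ≡.trans (≡.cong (λ w′ → count w′ j) col≡) (count≗ j)

  M : Matrix (List.length rows) (List.length (words k))
  M ρ c = ZH (row ρ) (count (col c))

  open RankDecomposition (rankDecomposition integral-minor (integral-≈0? char0) M
                                            (λ ρ c → integral-ZL (allFin N) (row ρ) (count (col c))))
  open IsRowBasis

  bC : Fin rank → Λ
  bC s = prodX (col (pivotCols s))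

  bS : Fin rank → Poly
  bS s = ZH (row (pivotRows s))

  module OnC = Coordinates K bC
  module OnS = Coordinates K bS

  bC-at-row : ∀ s ρ → bC s (row ρ) ≈ count! (col (pivotCols s)) * M ρ (pivotCols s)
  bC-at-row s ρ = prodX-at (col (pivotCols s)) (row ρ)

  bC-homogeneous : ∀ s {S} → ∣ S ∣ ≢ k → bC s S ≈ 0#
  bC-homogeneous s {S} ∣S∣≢k = prodX-homogeneous (col (pivotCols s)) S λ ∣S∣≡ → ∣S∣≢k (≡.trans ∣S∣≡ (col-length (pivotCols s)))

  count!-pivot≉0 : ∀ s → ¬ count! (col (pivotCols s)) ≈ 0#
  count!-pivot≉0 s = count!≉0 char0 (col (pivotCols s))

  bC-Cdeg : ∀ s → Cdeg k (bC s)
  bC-Cdeg s = ((1# , bC s) ∷ [] , (col (pivotCols s) , ≡.refl) ∷ [] , ≈-onSlim⇒≈Φ λ _ → sym (trans (+-identityʳ _) (*-identityˡ _)))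
            , bC s , ≈-onSlim⇒≈Φ (λ _ → refl) , λ S → bC-homogeneous s

  bC-independent : LΦ.LinearlyIndependent bC
  bC-independent x comb≈0 s = *-zero-cancelˡ (count!-pivot≉0 s) (trans (*-comm _ _) (independent colBasis _ rows≈0 s))
    where
    rows≈0 : ∀ ρ → sum (λ s → x s * count! (col (pivotCols s)) * M ρ (pivotCols s)) ≈ 0#
    rows≈0 ρ = begin
      sum (λ s → x s * count! (col (pivotCols s)) * M ρ (pivotCols s))
        ≈⟨ sum-cong-≋ (λ s → trans (*-assoc _ _ _) (*-congˡ (sym (bC-at-row s ρ)))) ⟩
      sum (λ s → x s * bC s (row ρ))   ≡⟨ OnC.comb-at x (row ρ) ⟨
      LΦ.comb bC x (row ρ)             ≈⟨ ≈Φ⇒≈-onSlim comb≈0 (proj₁ (row-slimWithKEdges ρ)) ⟩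
      0#                               ∎

  prodX-HasCoordinates : ∀ w → OnC.HasCoordinates SlimWithKEdges (prodX w)
  prodX-HasCoordinates w with List.length w ℕP.≟ k
  ... | no len≢k = (λ _ → 0#) , λ {S} (_ , ∣S∣≡k) →
          trans (prodX-homogeneous w S λ ∣S∣≡ → len≢k (≡.trans (≡.sym ∣S∣≡) ∣S∣≡k)) (sym (sum-≈0 λ s → zeroˡ (bC s S)))
  ... | yes len≡k with col-complete {w} len≡k
  ...   | c , ≡.refl = coords , λ S-slimWithKEdges → let (ρ , row≡) = row-complete S-slimWithKEdges in
                         ≡.subst (λ S → prodX w S ≈ sum (λ s → coords s * bC s S)) row≡ (at-row ρ)
    where
    y = proj₁ (spanning colBasis c)
    f⁻¹ : Fin rank → Carrier
    f⁻¹ s = (count! (col (pivotCols s)) ⁻¹) (count!-pivot≉0 s)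
    coords : Fin rank → Carrier
    coords s = count! w * y s * f⁻¹ s
    at-row : ∀ ρ → prodX w (row ρ) ≈ sum (λ s → coords s * bC s (row ρ))
    at-row ρ = begin
      prodX w (row ρ)                                  ≈⟨ prodX-at w (row ρ) ⟩
      count! w * M ρ c                                 ≈⟨ *-congˡ (proj₂ (spanning colBasis c) ρ) ⟩
      count! w * sum (λ s → y s * M ρ (pivotCols s))   ≈⟨ *-distribˡ-sum (count! w) (λ s → y s * M ρ (pivotCols s)) ⟩
      sum (λ s → count! w * (y s * M ρ (pivotCols s))) ≈⟨ sum-cong-≋ rescale ⟩
      sum (λ s → coords s * bC s (row ρ))              ∎
      where
      rescale : ∀ s → count! w * (y s * M ρ (pivotCols s)) ≈ coords s * bC s (row ρ)
      rescale s = begin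
        count! w * (y s * M ρ (pivotCols s))                                   ≈⟨ *-identityʳ _ ⟨
        count! w * (y s * M ρ (pivotCols s)) * 1#                              ≈⟨ *-congˡ (*-inverseˡ _ (count!-pivot≉0 s)) ⟨
        count! w * (y s * M ρ (pivotCols s)) * (f⁻¹ s * count! (col (pivotCols s)))
          ≈⟨ solve 5 (λ a y m i f → a :* (y :* m) :* (i :* f) := a :* y :* i :* (f :* m)) refl (count! w) (y s) (M ρ (pivotCols s)) (f⁻¹ s) _ ⟩
        coords s * (count! (col (pivotCols s)) * M ρ (pivotCols s))            ≈⟨ *-congˡ (bC-at-row s ρ) ⟨
        coords s * bC s (row ρ)                                                ∎

  bC-spans : ∀ v → Cdeg k v → Σ (Fin rank → Carrier) λ y → v ≈Φ LΦ.comb bC y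
  bC-spans v ((L , generators , v≈L) , (w , v≈w , w-homog)) = y , ≈-onSlim⇒≈Φ v≈comb
    where
    coordinates : OnC.HasCoordinates SlimWithKEdges (λ S → ∑ᴸ (λ q → proj₁ q * proj₂ q S) L)
    coordinates = OnC.lincomb-HasCoordinates L (All.map (λ (w , v≡) →
      ≡.subst (OnC.HasCoordinates SlimWithKEdges) (≡.sym v≡) (prodX-HasCoordinates w)) generators)
    y = proj₁ coordinates
    v≈comb : ∀ {S} → Slim S → v S ≈ LΦ.comb bC y S
    v≈comb {S} slim = byEdgeCount (∣ S ∣ ℕP.≟ k)
      where
      byEdgeCount : Dec (∣ S ∣ ≡ k) → v S ≈ LΦ.comb bC y S
      byEdgeCount (yes size) = begin
        v S                                ≈⟨ ≈Φ⇒≈-onSlim v≈L slim ⟩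
        LΦ.lincomb L S                     ≡⟨ foldr-+-at (λ q → proj₁ q ·Λ proj₂ q) L S ⟩
        ∑ᴸ (λ q → proj₁ q * proj₂ q S) L   ≈⟨ proj₂ coordinates (slim , size) ⟩
        sum (λ s → y s * bC s S)           ≡⟨ OnC.comb-at y S ⟨
        LΦ.comb bC y S                     ∎
      byEdgeCount (no size≢) = begin
        v S                                ≈⟨ ≈Φ⇒≈-onSlim v≈w slim ⟩
        w S                                ≈⟨ w-homog S size≢ ⟩
        0#                                 ≈⟨ sum-≈0 (λ s → trans (*-congˡ (bC-homogeneous s size≢)) (zeroʳ _)) ⟨
        sum (λ s → y s * bC s S)           ≡⟨ OnC.comb-at y S ⟨
        LΦ.comb bC y S                     ∎

  bS-homogeneous : ∀ s → HomogP k (bS s)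
  bS-homogeneous s α deg≢ = HomogP-ZH (row (pivotRows s)) α λ deg≡ → deg≢ (≡.trans deg≡ (proj₂ (row-slimWithKEdges (pivotRows s))))

  bS-Sdeg : ∀ s → Sdeg k (bS s)
  bS-Sdeg s = ((1# , bS s) ∷ [] , (row (pivotRows s) , proj₁ (row-slimWithKEdges (pivotRows s)) , ≡.refl) ∷ []
              , λ α → sym (trans (+-identityʳ _) (*-identityˡ _)))
            , bS-homogeneous s

  bS-independent : LP.LinearlyIndependent bS
  bS-independent x comb≈0 = independent rowBasis x λ c → trans (reflexive (≡.sym (OnS.comb-at x (count (col c))))) (comb≈0 (count (col c)))

  ZH-HasCoordinates : ∀ {H} → Slim H → OnS.HasCoordinates (λ α → totalDeg α ≡ k) (ZH H)
  ZH-HasCoordinates {H} slim = byEdgeCount (∣ H ∣ ℕP.≟ k)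
    where
    byEdgeCount : Dec (∣ H ∣ ≡ k) → OnS.HasCoordinates (λ α → totalDeg α ≡ k) (ZH H)
    byEdgeCount (no size≢) = (λ _ → 0#) , λ {α} deg≡ →
      trans (HomogP-ZH H α λ deg≡∣H∣ → size≢ (≡.trans (≡.sym deg≡∣H∣) deg≡)) (sym (sum-≈0 λ s → zeroˡ (bS s α)))
    byEdgeCount (yes size) = y , λ {α} deg≡ → let (c , count≗α) = col-for deg≡ in begin
      ZH H α                                ≡⟨ ≡.cong (λ H → ZH H α) (≡.sym row≡) ⟩
      ZH (row ρ) α                          ≈⟨ Extensional-ZL (allFin N) (row ρ) (≡.sym ∘ count≗α) ⟩
      M ρ c                                 ≈⟨ proj₂ (spanning rowBasis ρ) c ⟩
      sum (λ s → y s * M (pivotRows s) c)   ≈⟨ sum-cong-≋ (λ s → *-congˡ (Extensional-ZL (allFin N) (row (pivotRows s)) count≗α)) ⟩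
      sum (λ s → y s * bS s α)              ∎
      where
      ρ = proj₁ (row-complete (slim , size))
      row≡ = proj₂ (row-complete (slim , size))
      y = proj₁ (spanning rowBasis ρ)

  bS-spans : ∀ p → Sdeg k p → Σ (Fin rank → Carrier) λ y → p ≈P LP.comb bS y
  bS-spans p ((L , generators , p≈L) , p-homog) = y , λ α → byDegree α (totalDeg α ℕP.≟ k)
    where
    coordinates : OnS.HasCoordinates (λ α → totalDeg α ≡ k) (λ α → ∑ᴸ (λ q → proj₁ q * proj₂ q α) L)
    coordinates = OnS.lincomb-HasCoordinates L (All.map (λ (H , slim , p≡) →
      ≡.subst (OnS.HasCoordinates (λ α → totalDeg α ≡ k)) (≡.sym p≡) (ZH-HasCoordinates slim)) generators)
    y = proj₁ coordinates
    byDegree : ∀ α → Dec (totalDeg α ≡ k) → p α ≈ LP.comb bS y α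
    byDegree α (yes deg≡) = begin
      p α                                 ≈⟨ p≈L α ⟩
      LP.lincomb L α                      ≡⟨ foldr-+-at (λ q → proj₁ q ·P proj₂ q) L α ⟩
      ∑ᴸ (λ q → proj₁ q * proj₂ q α) L    ≈⟨ proj₂ coordinates deg≡ ⟩
      sum (λ s → y s * bS s α)            ≡⟨ OnS.comb-at y α ⟨
      LP.comb bS y α                      ∎
    byDegree α (no deg≢) = begin
      p α                                 ≈⟨ p-homog α deg≢ ⟩
      0#                                  ≈⟨ sum-≈0 (λ s → trans (*-congˡ (bS-homogeneous s α deg≢)) (zeroʳ _)) ⟨
      sum (λ s → y s * bS s α)            ≡⟨ OnS.comb-at y α ⟨
      LP.comb bS y α                      ∎

  dimensions : Σ ℕ λ d → LΦ.HasDimension (Cdeg k) d × LP.HasDimension (Sdeg k) d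
  dimensions = rank , (bC , bC-Cdeg , bC-independent , bC-spans) , (bS , bS-Sdeg , bS-independent , bS-spans)

mainTheorem3 : {c ℓ : Level} (K : Field c ℓ) → CharacteristicZero K →
    (n m : ℕ) (t : Fin n → Fin m) → Surjective t →
    (k : ℕ) →
    Σ ℕ (λ d → CompleteTiered.LΦ.HasDimension K t (CompleteTiered.Cdeg K t k) d
    × CompleteTiered.LP.HasDimension K t (CompleteTiered.Sdeg K t k) d)
mainTheorem3 K char0 n m t _ k = DimensionEquality.dimensions K char0 t k
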